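{- $$Q_{132}^{(0,1,0,0)}(t,x)=\frac{1}{1-tC(tx)}.$$ For $k>1$, $$Q_{132}^{(0,k,0,0)}(t,x)=\frac{1+t\sum_{j=0}^{k-2}C_jt^j\left(Q_{132}^{(0,k-1-j,0,0)}(t,x)-C(tx)\right)}{1-tC(tx)}$$ and $$Q_{132}^{(0,k,0,0)}(t,0)=\frac{1+t\sum_{j=0}^{k-2}C_jt^j\left(Q_{132}^{(0,k-1-j,0,0)}(t,0)-1\right)}{1-t}.$$
   Context: For $\sigma=\sigma_1\cdots\sigma_n\in S_n$ and $m\in\mathbb{N}$, $\mathrm{mmp}^{(0,m,0,0)}(\sigma)$ is the number of positions $i$ such that there are at least $m$ indices $j<i$ with $\sigma_j>\sigma_i$. $S_n(132)$ is the set of 132-avoiding permutations of $[n]$. $Q_{n,132}^{(0,m,0,0)}(x)=\sum_{\sigma\in S_n(132)}x^{\mathrm{mmp}^{(0,m,0,0)}(\sigma)}$ and $Q_{132}^{(0,m,0,0)}(t,x)=1+\sum_{n\ge1}t^nQ_{n,132}^{(0,m,0,0)}(x)$, a formal power series. $C(t)=\sum_{n\ge0}C_nt^n=\frac{1-\sqrt{1-4t}}{2t}$, $C_n=\frac{1}{n+1}\binom{2n}{n}$. -}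

module Defs where

open import Data.Nat as ℕ using (ℕ; zero; suc; _∸_; _≤ᵇ_; _<ᵇ_; _≡ᵇ_)
open import Data.Nat.Combinatorics using (_C_)
open import Data.Nat.DivMod using (_/_)
open import Data.Bool using (Bool; true; false; if_then_else_; _∧_; _∨_)
open import Data.List using (List; []; _∷_; concatMap; map; length; filter)
open import Data.Bool.ListAction using (any)
open import Data.Integer as ℤ using (ℤ; +_)
open import Relation.Binary.PropositionalEquality using (_≡_)

-- Permutations of [n] = {1,…,n}, as lists σ₁ ⋯ σₙ (one-line notation).
-- S n enumerates all of them (each exactly once), built by inserting n
-- into every position of every permutation of [n-1].

insertions : ℕ → List ℕ → List (List ℕ)
insertions a [] = (a ∷ []) ∷ []
insertions a (b ∷ l) = (a ∷ b ∷ l) ∷ map (b ∷_) (insertions a l)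

S : ℕ → List (List ℕ)
S zero = [] ∷ []
S (suc n) = concatMap (insertions (suc n)) (S n)

-- σ contains 132: there are positions i<j<k with σᵢ < σₖ < σⱼ.
-- has132from a l : a is the "1" of an occurrence whose "3" and "2" lie in l.
has132from : ℕ → List ℕ → Bool
has132from a [] = false
has132from a (b ∷ l) = ((a <ᵇ b) ∧ any (λ c → (a <ᵇ c) ∧ (c <ᵇ b)) l) ∨ has132from a l

has132 : List ℕ → Bool
has132 [] = false
has132 (a ∷ l) = has132from a l ∨ has132 l

avoids132 : List ℕ → Bool
avoids132 σ = if has132 σ then false else true

S132 : ℕ → List (List ℕ)
S132 n = filter (λ σ → avoids132 σ Data.Bool.≟ true) (S n)
  where import Data.Bool

countᵇ : (ℕ → Bool) → List ℕ → ℕ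
countᵇ p [] = 0
countᵇ p (a ∷ l) = (if p a then 1 else 0) ℕ.+ countᵇ p l

-- mmp^(0,m,0,0)(σ): number of positions i such that at least m indices
-- j<i satisfy σⱼ > σᵢ.  'pre' holds the entries σ₁…σ_{i-1} already read.
mmpAux : ℕ → List ℕ → List ℕ → ℕ
mmpAux m pre [] = 0
mmpAux m pre (a ∷ l) =
  (if m ≤ᵇ countᵇ (λ b → a <ᵇ b) pre then 1 else 0) ℕ.+ mmpAux m (a ∷ pre) l

mmp : ℕ → List ℕ → ℕ
mmp m σ = mmpAux m [] σ

-- Formal power series in t with coefficients in ℤ[x]:
-- F n i = coefficient of tⁿ xⁱ.

Ser2 : Set
Ser2 = ℕ → ℕ → ℤ

_≋_ : Ser2 → Ser2 → Set
F ≋ G = ∀ n i → F n i ≡ G n i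

Σ≤ : ℕ → (ℕ → ℤ) → ℤ
Σ≤ zero f = f 0
Σ≤ (suc n) f = Σ≤ n f ℤ.+ f (suc n)

_⊕_ : Ser2 → Ser2 → Ser2
(F ⊕ G) n i = F n i ℤ.+ G n i

_⊖_ : Ser2 → Ser2 → Ser2
(F ⊖ G) n i = F n i ℤ.- G n i

_⊛_ : Ser2 → Ser2 → Ser2
(F ⊛ G) n i = Σ≤ n λ a → Σ≤ i λ b → F a b ℤ.* G (n ∸ a) (i ∸ b)

δ : ℕ → ℕ → ℤ
δ a b = if a ≡ᵇ b then + 1 else + 0

𝟙 : Ser2
𝟙 n i = δ n 0 ℤ.* δ i 0

tpow : ℕ → Ser2
tpow j n i = δ n j ℤ.* δ i 0

_·_ : ℤ → Ser2 → Ser2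
(c · F) n i = c ℤ.* F n i

ΣS : ℕ → (ℕ → Ser2) → Ser2
ΣS k G n i = Σ≤ k λ j → G j n i

Cat : ℕ → ℕ
Cat n = ((2 ℕ.* n) C n) / suc n

Ctx : Ser2
Ctx n i = δ n i ℤ.* + Cat n

-- Q_{n,132}^{(0,m,0,0)}(x) coefficients, and the generating function
-- Q_{132}^{(0,m,0,0)}(t,x) = 1 + Σ_{n≥1} tⁿ Q_{n,132}^{(0,m,0,0)}(x)
Qcoef : ℕ → ℕ → ℕ → ℕ
Qcoef m n i = length (filter (λ σ → mmp m σ ℕ.≟ i) (S132 n))

Q : ℕ → Ser2
Q m zero i = δ i 0
Q m (suc n) i = + Qcoef m (suc n) i

-- Series in t alone (for the specialisation x = 0): coefficient of tⁿ.

Ser1 : Set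
Ser1 = ℕ → ℤ

_≋₁_ : Ser1 → Ser1 → Set
f ≋₁ g = ∀ n → f n ≡ g n

at0 : Ser2 → Ser1
at0 F n = F n 0

_⊕₁_ : Ser1 → Ser1 → Ser1
(f ⊕₁ g) n = f n ℤ.+ g n

_⊖₁_ : Ser1 → Ser1 → Ser1
(f ⊖₁ g) n = f n ℤ.- g n

_⊛₁_ : Ser1 → Ser1 → Ser1
(f ⊛₁ g) n = Σ≤ n λ a → f a ℤ.* g (n ∸ a)

_·₁_ : ℤ → Ser1 → Ser1
(c ·₁ f) n = c ℤ.* f n

𝟙₁ : Ser1
𝟙₁ n = δ n 0

tpow₁ : ℕ → Ser1
tpow₁ j n = δ n j

ΣS₁ : ℕ → (ℕ → Ser1) → Ser1
ΣS₁ k g n = Σ≤ k λ j → g j n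

module Submission where

-- Idea.  In a 132-avoider τ of [n+1] write τ = α' (n+1) β with |α'| = a.
-- Avoiding 132 forces every entry of α' to exceed every entry of β, so
-- α' is α shifted up by n - a, and τ ↦ (α, β) is a bijection onto
-- S_a(132) × S_{n-a}(132).  Every entry of β is preceded by the a + 1
-- larger entries of α'(n+1), whence
--     mmp^(m)(τ) = mmp^(m)(α) + mmp^(m-1-a)(β)            (m ≥ 1).
-- Hence [tⁿ⁺¹] Q_m = Σ_a [tᵃ] Q_m · [tⁿ⁻ᵃ] Q_{m-1-a}; moreover Q_0 = C(tx)
-- and [tᵃ] Q_m = C_a for a < m.  Subtracting t·Q_m·C(tx) from Q_m leaves
-- exactly the terms a < m - 1, which is all three identities.  That
-- |S_n(132)| equals the closed form C_n is derived from the same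
-- decomposition (Segner's recurrence) via ballot numbers.

open import Defs
open import Data.Nat using (ℕ; suc; _∸_)
open import Data.Integer using (+_)
open import Data.Product using (_×_)

open import Data.Nat as ℕ using (zero; _≤_; _<_; z≤n; s≤s; _≤ᵇ_; _<ᵇ_; _≡ᵇ_; _⊓_)
import Data.Nat.Properties as ℕP
import Data.Nat.Tactic.RingSolver as ℕSolver
open import Data.Nat.Combinatorics using (_C_; nCk+nC[k+1]≡[n+1]C[k+1]; k>n⇒nCk≡0; nC1≡n)
open import Data.Nat.DivMod using (_/_; m*n/n≡m)
open import Data.Integer as ℤ using (ℤ; 0ℤ; 1ℤ)
import Data.Integer.Properties as ℤP
open import Data.Integer.Tactic.RingSolver using (solve-∀)
open import Data.Bool using (Bool; true; false; if_then_else_; _∧_; _∨_; not; T)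
import Data.Bool as Bool
import Data.Bool.Properties as BoolP
open import Data.Bool.ListAction using (any)
open import Data.List using (List; []; _∷_; _++_; _ʳ++_; map; concatMap; length; take; drop; filter)
import Data.List.Properties as ListP
open import Data.List.Relation.Unary.All as All using (All; []; _∷_)
import Data.List.Relation.Unary.All.Properties as AllP
open import Data.Product using (_,_; proj₂)
open import Data.Sum using (_⊎_; inj₁; inj₂)
open import Data.Empty using (⊥-elim)
open import Data.Unit using (tt)
open import Function using (_∘_)
open import Relation.Nullary using (¬_; Dec; yes; no; does)
open import Relation.Unary using (Decidable)
open import Relation.Binary.PropositionalEquality

-- Boolean comparisons of naturals, turned into equations with true/false
-- so that they can be rewritten inside definitions from Defs.

true-if : ∀ {b} → T b → b ≡ true
true-if {true} _ = refl

false-unless : ∀ {b} → ¬ T b → b ≡ false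
false-unless {false} _ = refl
false-unless {true} ¬t = ⊥-elim (¬t tt)

≡ᵇ-refl : ∀ a → (a ≡ᵇ a) ≡ true
≡ᵇ-refl a = true-if (ℕP.≡⇒≡ᵇ a a refl)

≡ᵇ-false : ∀ {a b} → ¬ a ≡ b → (a ≡ᵇ b) ≡ false
≡ᵇ-false {a} {b} a≢b = false-unless (a≢b ∘ ℕP.≡ᵇ⇒≡ a b)

≡ᵇ-sym : ∀ a b → (a ≡ᵇ b) ≡ (b ≡ᵇ a)
≡ᵇ-sym zero zero = refl
≡ᵇ-sym zero (suc b) = refl
≡ᵇ-sym (suc a) zero = refl
≡ᵇ-sym (suc a) (suc b) = ≡ᵇ-sym a b

≤ᵇ-true : ∀ {a b} → a ≤ b → (a ≤ᵇ b) ≡ true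
≤ᵇ-true a≤b = true-if (ℕP.≤⇒≤ᵇ a≤b)

≤ᵇ-false : ∀ {a b} → b < a → (a ≤ᵇ b) ≡ false
≤ᵇ-false {a} {b} b<a = false-unless (ℕP.<⇒≱ b<a ∘ ℕP.≤ᵇ⇒≤ a b)

<ᵇ-true : ∀ {a b} → a < b → (a <ᵇ b) ≡ true
<ᵇ-true a<b = true-if (ℕP.<⇒<ᵇ a<b)

<ᵇ-false : ∀ {a b} → b ≤ a → (a <ᵇ b) ≡ false
<ᵇ-false {a} {b} b≤a = false-unless (ℕP.≤⇒≯ b≤a ∘ ℕP.<ᵇ⇒< a b)

-- The Iverson bracket; note that δ a b is ⟦ a ≡ᵇ b ⟧ by definition.
⟦_⟧ : Bool → ℤ
⟦ b ⟧ = if b then + 1 else + 0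

δ-refl : ∀ a → δ a a ≡ 1ℤ
δ-refl a rewrite ≡ᵇ-refl a = refl

δ-≢ : ∀ {a b} → ¬ a ≡ b → δ a b ≡ 0ℤ
δ-≢ a≢b rewrite ≡ᵇ-false a≢b = refl

Σ-cong : ∀ n {f g : ℕ → ℤ} → (∀ a → a ≤ n → f a ≡ g a) → Σ≤ n f ≡ Σ≤ n g
Σ-cong zero f≗g = f≗g 0 z≤n
Σ-cong (suc n) f≗g =
  cong₂ ℤ._+_ (Σ-cong n (λ a a≤n → f≗g a (ℕP.m≤n⇒m≤1+n a≤n))) (f≗g (suc n) ℕP.≤-refl)

Σ-cong′ : ∀ n {f g : ℕ → ℤ} → (∀ a → f a ≡ g a) → Σ≤ n f ≡ Σ≤ n g
Σ-cong′ n f≗g = Σ-cong n (λ a _ → f≗g a)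

Σ-zero : ∀ n {f : ℕ → ℤ} → (∀ a → a ≤ n → f a ≡ 0ℤ) → Σ≤ n f ≡ 0ℤ
Σ-zero zero f≗0 = f≗0 0 z≤n
Σ-zero (suc n) f≗0 =
  cong₂ ℤ._+_ (Σ-zero n (λ a a≤n → f≗0 a (ℕP.m≤n⇒m≤1+n a≤n))) (f≗0 (suc n) ℕP.≤-refl)

Σ-add : ∀ n (f g : ℕ → ℤ) → Σ≤ n (λ a → f a ℤ.+ g a) ≡ Σ≤ n f ℤ.+ Σ≤ n g
Σ-add zero f g = refl
Σ-add (suc n) f g rewrite Σ-add n f g = regroup (Σ≤ n f) (Σ≤ n g) (f (suc n)) (g (suc n))
  where
  regroup : ∀ a b c d → (a ℤ.+ b) ℤ.+ (c ℤ.+ d) ≡ (a ℤ.+ c) ℤ.+ (b ℤ.+ d)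
  regroup = solve-∀

Σ-sub : ∀ n (f g : ℕ → ℤ) → Σ≤ n (λ a → f a ℤ.- g a) ≡ Σ≤ n f ℤ.- Σ≤ n g
Σ-sub zero f g = refl
Σ-sub (suc n) f g rewrite Σ-sub n f g = regroup (Σ≤ n f) (Σ≤ n g) (f (suc n)) (g (suc n))
  where
  regroup : ∀ a b c d → (a ℤ.- b) ℤ.+ (c ℤ.- d) ≡ (a ℤ.+ c) ℤ.- (b ℤ.+ d)
  regroup = solve-∀

Σ-*ˡ : ∀ n c (f : ℕ → ℤ) → Σ≤ n (λ a → c ℤ.* f a) ≡ c ℤ.* Σ≤ n f
Σ-*ˡ zero c f = refl
Σ-*ˡ (suc n) c f rewrite Σ-*ˡ n c f = sym (ℤP.*-distribˡ-+ c (Σ≤ n f) (f (suc n)))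

Σ-*ʳ : ∀ n c (f : ℕ → ℤ) → Σ≤ n (λ a → f a ℤ.* c) ≡ Σ≤ n f ℤ.* c
Σ-*ʳ zero c f = refl
Σ-*ʳ (suc n) c f rewrite Σ-*ʳ n c f = sym (ℤP.*-distribʳ-+ c (Σ≤ n f) (f (suc n)))

Σ-peel : ∀ n (f : ℕ → ℤ) → Σ≤ (suc n) f ≡ f 0 ℤ.+ Σ≤ n (λ a → f (suc a))
Σ-peel zero f = refl
Σ-peel (suc n) f rewrite Σ-peel n f = ℤP.+-assoc (f 0) _ _

Σ-trunc : ∀ n p (f : ℕ → ℤ) → p ≤ n → (∀ q → p < q → q ≤ n → f q ≡ 0ℤ) → Σ≤ n f ≡ Σ≤ p f
Σ-trunc zero .zero f z≤n tail≡0 = refl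
Σ-trunc (suc n) p f p≤1+n tail≡0 with ℕP.m≤n⇒m<n∨m≡n p≤1+n
... | inj₂ refl = refl
... | inj₁ (s≤s p≤n) = begin
    Σ≤ n f ℤ.+ f (suc n)
      ≡⟨ cong₂ ℤ._+_ (Σ-trunc n p f p≤n (λ q p<q q≤n → tail≡0 q p<q (ℕP.m≤n⇒m≤1+n q≤n)))
                     (tail≡0 (suc n) (s≤s p≤n) ℕP.≤-refl) ⟩
    Σ≤ p f ℤ.+ 0ℤ
      ≡⟨ ℤP.+-identityʳ _ ⟩
    Σ≤ p f ∎
  where open ≡-Reasoning

Σ-δ : ∀ n j (f : ℕ → ℤ) → j ≤ n → Σ≤ n (λ a → δ a j ℤ.* f a) ≡ f j
Σ-δ-beyond : ∀ n j (f : ℕ → ℤ) → n < j → Σ≤ n (λ a → δ a j ℤ.* f a) ≡ 0ℤ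
Σ-δ zero zero f z≤n = ℤP.*-identityˡ (f 0)
Σ-δ (suc n) j f j≤1+n with ℕP.m≤n⇒m<n∨m≡n j≤1+n
... | inj₂ refl rewrite Σ-δ-beyond n (suc n) f ℕP.≤-refl | δ-refl (suc n) =
  trans (ℤP.+-identityˡ _) (ℤP.*-identityˡ _)
... | inj₁ (s≤s j≤n) rewrite Σ-δ n j f j≤n | δ-≢ (λ e → ℕP.<-irrefl (sym e) (s≤s j≤n)) =
  ℤP.+-identityʳ (f j)
Σ-δ-beyond zero (suc j) f n<j = refl
Σ-δ-beyond (suc n) j f n<j rewrite Σ-δ-beyond n j f (ℕP.<-trans ℕP.≤-refl n<j) | δ-≢ (λ e → ℕP.<-irrefl e n<j) =
  refl

Σ-δ-last : ∀ n (f : ℕ → ℤ) → Σ≤ n (λ a → f a ℤ.* δ (n ∸ a) 0) ≡ f n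
Σ-δ-last n f = begin
    Σ≤ n (λ a → f a ℤ.* δ (n ∸ a) 0)
      ≡⟨ Σ-cong n (λ a a≤n → trans (ℤP.*-comm (f a) _) (cong (ℤ._* f a) (complement a a≤n))) ⟩
    Σ≤ n (λ a → δ a n ℤ.* f a)
      ≡⟨ Σ-δ n n f ℕP.≤-refl ⟩
    f n ∎
  where
  open ≡-Reasoning
  complement : ∀ a → a ≤ n → δ (n ∸ a) 0 ≡ δ a n
  complement a a≤n with a ℕ.≟ n
  ... | yes refl rewrite ℕP.n∸n≡0 a | δ-refl a = refl
  ... | no a≢n rewrite δ-≢ a≢n = δ-≢ (λ e → a≢n (ℕP.≤-antisym a≤n (ℕP.m∸n≡0⇒m≤n e)))

Σ-restrict : ∀ n k (g : ℕ → ℤ) → Σ≤ n (λ a → if a ≤ᵇ k then g a else 0ℤ) ≡ Σ≤ (n ⊓ k) g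
Σ-restrict zero k g = refl
Σ-restrict (suc n) k g with ℕP.≤-<-connex (suc n) k
... | inj₁ 1+n≤k rewrite ≤ᵇ-true 1+n≤k | Σ-restrict n k g | ℕP.m≤n⇒m⊓n≡m 1+n≤k
                       | ℕP.m≤n⇒m⊓n≡m (ℕP.<⇒≤ {n} 1+n≤k) = refl
... | inj₂ (s≤s k≤n) rewrite ≤ᵇ-false {suc n} {k} (s≤s k≤n) | Σ-restrict n k g
                           | ℕP.m≥n⇒m⊓n≡n (ℕP.m≤n⇒m≤1+n k≤n) | ℕP.m≥n⇒m⊓n≡n k≤n = ℤP.+-identityʳ _

Σ-restrict-swap : ∀ n k (g : ℕ → ℤ) →
  Σ≤ n (λ a → if a ≤ᵇ k then g a else 0ℤ) ≡ Σ≤ k (λ a → if a ≤ᵇ n then g a else 0ℤ)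
Σ-restrict-swap n k g rewrite Σ-restrict n k g | Σ-restrict k n g | ℕP.⊓-comm n k = refl

Σ-triangle : ∀ n (F : ℕ → ℕ → ℕ → ℤ) →
  Σ≤ n (λ a → Σ≤ a (λ x → F x (a ∸ x) (n ∸ a))) ≡ Σ≤ n (λ x → Σ≤ (n ∸ x) (λ y → F x y (n ∸ x ∸ y)))
Σ-triangle zero F = refl
Σ-triangle (suc n) F = begin
    Σ≤ (suc n) (λ a → Σ≤ a (λ x → F x (a ∸ x) (suc n ∸ a)))
      ≡⟨ Σ-peel n _ ⟩
    F 0 0 (suc n) ℤ.+ Σ≤ n (λ a → Σ≤ (suc a) (λ x → F x (suc a ∸ x) (n ∸ a)))
      ≡⟨ cong (λ z → F 0 0 (suc n) ℤ.+ z) (Σ-cong′ n (λ a → Σ-peel a _)) ⟩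
    F 0 0 (suc n) ℤ.+ Σ≤ n (λ a → F 0 (suc a) (n ∸ a) ℤ.+ Σ≤ a (λ x → F (suc x) (a ∸ x) (n ∸ a)))
      ≡⟨ cong (λ z → F 0 0 (suc n) ℤ.+ z) (Σ-add n _ _) ⟩
    F 0 0 (suc n) ℤ.+ (column₀ ℤ.+ Σ≤ n (λ a → Σ≤ a (λ x → F (suc x) (a ∸ x) (n ∸ a))))
      ≡⟨ cong (λ z → F 0 0 (suc n) ℤ.+ (column₀ ℤ.+ z)) (Σ-triangle n (λ x → F (suc x))) ⟩
    F 0 0 (suc n) ℤ.+ (column₀ ℤ.+ rest)
      ≡⟨ sym (ℤP.+-assoc (F 0 0 (suc n)) column₀ rest) ⟩
    (F 0 0 (suc n) ℤ.+ column₀) ℤ.+ rest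
      ≡⟨ cong (ℤ._+ rest) (sym (Σ-peel n (λ y → F 0 y (suc n ∸ y)))) ⟩
    Σ≤ (suc n) (λ y → F 0 y (suc n ∸ y)) ℤ.+ rest
      ≡⟨ sym (Σ-peel n _) ⟩
    Σ≤ (suc n) (λ x → Σ≤ (suc n ∸ x) (λ y → F x y (suc n ∸ x ∸ y))) ∎
  where
  open ≡-Reasoning
  column₀ = Σ≤ n (λ a → F 0 (suc a) (n ∸ a))
  rest = Σ≤ n (λ x → Σ≤ (n ∸ x) (λ y → F (suc x) y (n ∸ x ∸ y)))

ΣL : (List ℕ → ℤ) → List (List ℕ) → ℤ
ΣL w [] = 0ℤ
ΣL w (σ ∷ L) = w σ ℤ.+ ΣL w L

ΣL-++ : ∀ w L M → ΣL w (L ++ M) ≡ ΣL w L ℤ.+ ΣL w M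
ΣL-++ w [] M = sym (ℤP.+-identityˡ _)
ΣL-++ w (σ ∷ L) M rewrite ΣL-++ w L M = sym (ℤP.+-assoc (w σ) _ _)

ΣL-map : ∀ w f L → ΣL w (map f L) ≡ ΣL (w ∘ f) L
ΣL-map w f [] = refl
ΣL-map w f (σ ∷ L) rewrite ΣL-map w f L = refl

ΣL-concatMap : ∀ w (f : List ℕ → List (List ℕ)) L → ΣL w (concatMap f L) ≡ ΣL (λ σ → ΣL w (f σ)) L
ΣL-concatMap w f [] = refl
ΣL-concatMap w f (σ ∷ L) =
  trans (ΣL-++ w (f σ) (concatMap f L)) (cong (λ z → ΣL w (f σ) ℤ.+ z) (ΣL-concatMap w f L))

ΣL-congᴾ : ∀ {P : List ℕ → Set} {f g} {L} → All P L → (∀ σ → P σ → f σ ≡ g σ) → ΣL f L ≡ ΣL g L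
ΣL-congᴾ [] f≗g = refl
ΣL-congᴾ (pσ ∷ pL) f≗g = cong₂ ℤ._+_ (f≗g _ pσ) (ΣL-congᴾ pL f≗g)

ΣL-cong : ∀ {f g} L → (∀ σ → f σ ≡ g σ) → ΣL f L ≡ ΣL g L
ΣL-cong [] f≗g = refl
ΣL-cong (σ ∷ L) f≗g = cong₂ ℤ._+_ (f≗g σ) (ΣL-cong L f≗g)

ΣL-*ˡ : ∀ c f L → ΣL (λ σ → c ℤ.* f σ) L ≡ c ℤ.* ΣL f L
ΣL-*ˡ c f [] = sym (ℤP.*-zeroʳ c)
ΣL-*ˡ c f (σ ∷ L) rewrite ΣL-*ˡ c f L = sym (ℤP.*-distribˡ-+ c (f σ) _)

ΣL-*ʳ : ∀ c f L → ΣL (λ σ → f σ ℤ.* c) L ≡ ΣL f L ℤ.* c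
ΣL-*ʳ c f [] = sym (ℤP.*-zeroˡ c)
ΣL-*ʳ c f (σ ∷ L) rewrite ΣL-*ʳ c f L = sym (ℤP.*-distribʳ-+ c (f σ) _)

ΣL-Σ : ∀ n (f : List ℕ → ℕ → ℤ) L → ΣL (λ σ → Σ≤ n (f σ)) L ≡ Σ≤ n (λ q → ΣL (λ σ → f σ q) L)
ΣL-Σ n f [] = sym (Σ-zero n (λ _ _ → refl))
ΣL-Σ n f (σ ∷ L) rewrite ΣL-Σ n f L = sym (Σ-add n (f σ) (λ q → ΣL (λ σ → f σ q) L))

ΣL-product : ∀ f g L M → ΣL (λ σ → ΣL (λ τ → f σ ℤ.* g τ) M) L ≡ ΣL f L ℤ.* ΣL g M
ΣL-product f g L M = trans (ΣL-cong L (λ σ → ΣL-*ˡ (f σ) g M)) (ΣL-*ʳ (ΣL g M) f L)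

length-filter : ∀ {P : List ℕ → Set} (P? : Decidable P) L →
  + length (filter P? L) ≡ ΣL (λ σ → ⟦ does (P? σ) ⟧) L
length-filter P? [] = refl
length-filter P? (σ ∷ L) with does (P? σ)
... | true = cong (λ z → + 1 ℤ.+ z) (length-filter P? L)
... | false = trans (length-filter P? L) (sym (ℤP.+-identityˡ _))

ΣL-filter : ∀ {P : List ℕ → Set} (P? : Decidable P) w L →
  ΣL w (filter P? L) ≡ ΣL (λ σ → ⟦ does (P? σ) ⟧ ℤ.* w σ) L
ΣL-filter P? w [] = refl
ΣL-filter P? w (σ ∷ L) with does (P? σ)
... | true = cong₂ ℤ._+_ (sym (ℤP.*-identityˡ (w σ))) (ΣL-filter P? w L)
... | false = trans (ΣL-filter P? w L)
                    (sym (trans (cong (ℤ._+ ΣL (λ σ → ⟦ does (P? σ) ⟧ ℤ.* w σ) L) (ℤP.*-zeroˡ (w σ)))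
                                (ℤP.+-identityˡ _)))

-- Permutations by insertion.  S (n+1) lists, for each ρ ∈ S n, the words
-- ins q (n+1) ρ obtained by inserting n+1 at position q ≤ n.

ins : ℕ → ℕ → List ℕ → List ℕ
ins zero a l = a ∷ l
ins (suc q) a [] = a ∷ []
ins (suc q) a (b ∷ l) = b ∷ ins q a l

ins-split : ∀ q a σ → ins q a σ ≡ take q σ ++ a ∷ drop q σ
ins-split zero a σ = refl
ins-split (suc q) a [] = refl
ins-split (suc q) a (b ∷ σ) = cong (b ∷_) (ins-split q a σ)

ΣL-insertions : ∀ a l w → ΣL w (insertions a l) ≡ Σ≤ (length l) (λ q → w (ins q a l))
ΣL-insertions a [] w = ℤP.+-identityʳ _
ΣL-insertions a (b ∷ l) w = begin
    w (a ∷ b ∷ l) ℤ.+ ΣL w (map (b ∷_) (insertions a l))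
      ≡⟨ cong (λ z → w (a ∷ b ∷ l) ℤ.+ z)
              (trans (ΣL-map w (b ∷_) (insertions a l)) (ΣL-insertions a l (λ σ → w (b ∷ σ)))) ⟩
    w (a ∷ b ∷ l) ℤ.+ Σ≤ (length l) (λ q → w (b ∷ ins q a l))
      ≡⟨ sym (Σ-peel (length l) (λ q → w (ins q a (b ∷ l)))) ⟩
    Σ≤ (suc (length l)) (λ q → w (ins q a (b ∷ l))) ∎
  where open ≡-Reasoning

All-ins : ∀ {P : ℕ → Set} q a l → P a → All P l → All P (ins q a l)
All-ins zero a l pa pl = pa ∷ pl
All-ins (suc q) a [] pa pl = pa ∷ []
All-ins (suc q) a (b ∷ l) pa (pb ∷ pl) = pb ∷ All-ins q a l pa pl

length-ins : ∀ q a l → length (ins q a l) ≡ suc (length l)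
length-ins zero a l = refl
length-ins (suc q) a [] = refl
length-ins (suc q) a (b ∷ l) = cong suc (length-ins q a l)

All-insertions : ∀ {P : List ℕ → Set} a l → (∀ q → q ≤ length l → P (ins q a l)) → All P (insertions a l)
All-insertions a [] P-ins = P-ins 0 z≤n ∷ []
All-insertions {P} a (b ∷ l) P-ins =
  P-ins 0 z≤n ∷ AllP.map⁺ (All-insertions {λ σ → P (b ∷ σ)} a l (λ q q≤ → P-ins (suc q) (s≤s q≤)))

All-concatMap : ∀ {P R : List ℕ → Set} (f : List ℕ → List (List ℕ)) L →
  All P L → (∀ σ → P σ → All R (f σ)) → All R (concatMap f L)
All-concatMap f [] [] P⇒R = []
All-concatMap f (σ ∷ L) (pσ ∷ pL) P⇒R = AllP.++⁺ (P⇒R σ pσ) (All-concatMap f L pL P⇒R)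

Word : ℕ → List ℕ → Set
Word n σ = (length σ ≡ n) × All (λ x → 0 < x × x ≤ n) σ

S-words : ∀ n → All (Word n) (S n)
S-words zero = (refl , []) ∷ []
S-words (suc n) = All-concatMap (insertions (suc n)) (S n) (S-words n)
  (λ σ (|σ|≡n , σ⊆[n]) → All-insertions (suc n) σ (λ q _ →
     trans (length-ins q (suc n) σ) (cong suc |σ|≡n) ,
     All-ins q (suc n) σ (s≤s z≤n , ℕP.≤-refl) (All.map (λ (0<x , x≤n) → 0<x , ℕP.m≤n⇒m≤1+n x≤n) σ⊆[n])))

entries<1+n : ∀ {n σ} → All (λ x → 0 < x × x ≤ n) σ → All (_< suc n) σ
entries<1+n = All.map (λ (_ , x≤n) → s≤s x≤n)

-- The block decomposition.  A word σ ∈ S n whose first p entries all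
-- exceed its last n - p entries is exactly shift (n - p) α ++ β with
-- α ∈ S p and β ∈ S (n - p).

shift : ℕ → List ℕ → List ℕ
shift k = map (k ℕ.+_)

dominates : List ℕ → List ℕ → Bool
dominates [] y = true
dominates (a ∷ x) y = not (any (λ c → a <ᵇ c) y) ∧ dominates x y

any-false : ∀ (P : ℕ → Bool) y → All (λ c → P c ≡ false) y → any P y ≡ false
any-false P [] [] = refl
any-false P (c ∷ y) (Pc≡false ∷ rest) = cong₂ _∨_ Pc≡false (any-false P y rest)

any-ins : ∀ P q a l → P a ≡ true → any P (ins q a l) ≡ true
any-ins P zero a l Pa = cong (_∨ any P l) Pa
any-ins P (suc q) a [] Pa = cong (_∨ false) Pa
any-ins P (suc q) a (b ∷ l) Pa = trans (cong (P b ∨_) (any-ins P q a l Pa)) (BoolP.∨-zeroʳ (P b))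

any-drop-ins : ∀ P p q a l → p ≤ q → q ≤ length l → P a ≡ true → any P (drop p (ins q a l)) ≡ true
any-drop-ins P zero q a l _ _ Pa = any-ins P q a l Pa
any-drop-ins P (suc p) (suc q) a (b ∷ l) (s≤s p≤q) (s≤s q≤) Pa = any-drop-ins P p q a l p≤q q≤ Pa

take-ins : ∀ q p a l → q ≤ p → take (suc p) (ins q a l) ≡ ins q a (take p l)
take-ins zero p a l _ = refl
take-ins (suc q) (suc p) a [] _ = refl
take-ins (suc q) (suc p) a (b ∷ l) (s≤s q≤p) = cong (b ∷_) (take-ins q p a l q≤p)

drop-ins : ∀ q p a l → q ≤ p → drop (suc p) (ins q a l) ≡ drop p l
drop-ins zero p a l _ = refl
drop-ins (suc q) (suc p) a [] _ = refl
drop-ins (suc q) (suc p) a (b ∷ l) (s≤s q≤p) = drop-ins q p a l q≤p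

dominates-ins : ∀ q N x y → All (_< N) y → dominates (ins q N x) y ≡ dominates x y
dominates-ins q N x y y<N = go q x
  where
  N-dominates : any (λ c → N <ᵇ c) y ≡ false
  N-dominates = any-false (λ c → N <ᵇ c) y (All.map (λ c<N → <ᵇ-false (ℕP.<⇒≤ c<N)) y<N)
  go : ∀ q x → dominates (ins q N x) y ≡ dominates x y
  go zero x = cong (λ b → not b ∧ dominates x y) N-dominates
  go (suc q) [] = cong (λ b → not b ∧ true) N-dominates
  go (suc q) (b ∷ x) rewrite go q x = refl

dominates-broken : ∀ p q N ρ → p < q → q ≤ length ρ → All (_< N) ρ →
  dominates (take (suc p) (ins q N ρ)) (drop (suc p) (ins q N ρ)) ≡ false
dominates-broken p (suc q) N (b ∷ ρ) (s≤s p≤q) (s≤s q≤) (b<N ∷ _) =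
  cong (λ z → not z ∧ dominates (take p (ins q N ρ)) (drop p (ins q N ρ)))
       (any-drop-ins (λ c → b <ᵇ c) p q N ρ p≤q q≤ (<ᵇ-true b<N))

shift-ins : ∀ q k a α → ins q (k ℕ.+ a) (shift k α) ≡ shift k (ins q a α)
shift-ins zero k a α = refl
shift-ins (suc q) k a [] = refl
shift-ins (suc q) k a (b ∷ α) = cong ((k ℕ.+ b) ∷_) (shift-ins q k a α)

-- One step of the block decomposition: among the insertions of n'+1 into
-- ρ ∈ S n', those keeping a dominating first block of length p'+1 insert
-- n'+1 into that block, which must itself be the first p' entries of ρ.
dominating-insertions : ∀ n' p' (h : List ℕ → List ℕ → ℤ) ρ → p' ≤ n' → Word n' ρ →
  Σ≤ (length ρ) (λ q → let σ = ins q (suc n') ρ in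
                       ⟦ dominates (take (suc p') σ) (drop (suc p') σ) ⟧ ℤ.* h (take (suc p') σ) (drop (suc p') σ))
  ≡ ⟦ dominates (take p' ρ) (drop p' ρ) ⟧ ℤ.* Σ≤ p' (λ q → h (ins q (suc n') (take p' ρ)) (drop p' ρ))
dominating-insertions n' p' h ρ p'≤n' (|ρ|≡n' , ρ⊆[n']) = begin
    Σ≤ (length ρ) term
      ≡⟨ Σ-trunc (length ρ) p' term (subst (p' ≤_) (sym |ρ|≡n') p'≤n') late ⟩
    Σ≤ p' term
      ≡⟨ Σ-cong p' early ⟩
    Σ≤ p' (λ q → ⟦ dominates (take p' ρ) (drop p' ρ) ⟧ ℤ.* h (ins q N (take p' ρ)) (drop p' ρ))
      ≡⟨ Σ-*ˡ p' ⟦ dominates (take p' ρ) (drop p' ρ) ⟧ (λ q → h (ins q N (take p' ρ)) (drop p' ρ)) ⟩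
    ⟦ dominates (take p' ρ) (drop p' ρ) ⟧ ℤ.* Σ≤ p' (λ q → h (ins q N (take p' ρ)) (drop p' ρ)) ∎
  where
  open ≡-Reasoning
  N = suc n'
  ρ<N = entries<1+n ρ⊆[n']
  term : ℕ → ℤ
  term q = ⟦ dominates (take (suc p') (ins q N ρ)) (drop (suc p') (ins q N ρ)) ⟧
           ℤ.* h (take (suc p') (ins q N ρ)) (drop (suc p') (ins q N ρ))
  late : ∀ q → p' < q → q ≤ length ρ → term q ≡ 0ℤ
  late q p'<q q≤ rewrite dominates-broken p' q N ρ p'<q q≤ ρ<N =
    ℤP.*-zeroˡ (h (take (suc p') (ins q N ρ)) (drop (suc p') (ins q N ρ)))
  early : ∀ q → q ≤ p' → term q ≡ ⟦ dominates (take p' ρ) (drop p' ρ) ⟧ ℤ.* h (ins q N (take p' ρ)) (drop p' ρ)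
  early q q≤p' rewrite take-ins q p' N ρ q≤p' | drop-ins q p' N ρ q≤p'
                     | dominates-ins q N (take p' ρ) (drop p' ρ) (AllP.drop⁺ p' ρ<N) = refl

shifted-insertions : ∀ p' k N (h : List ℕ → List ℕ → ℤ) α → N ≡ k ℕ.+ suc p' → length α ≡ p' →
  ΣL (λ β → Σ≤ p' (λ q → h (ins q N (shift k α)) β)) (S k)
  ≡ ΣL (λ τ → ΣL (λ β → h (shift k τ) β) (S k)) (insertions (suc p') α)
shifted-insertions p' k N h α refl refl = begin
    ΣL (λ β → Σ≤ p' (λ q → h (ins q (k ℕ.+ suc p') (shift k α)) β)) (S k)
      ≡⟨ ΣL-cong (S k) (λ β → Σ-cong′ p' (λ q → cong (λ τ → h τ β) (shift-ins q k (suc p') α))) ⟩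
    ΣL (λ β → Σ≤ p' (λ q → h (shift k (ins q (suc p') α)) β)) (S k)
      ≡⟨ ΣL-Σ p' (λ β q → h (shift k (ins q (suc p') α)) β) (S k) ⟩
    Σ≤ p' (λ q → ΣL (λ β → h (shift k (ins q (suc p') α)) β) (S k))
      ≡⟨ sym (ΣL-insertions (suc p') α (λ τ → ΣL (λ β → h (shift k τ) β) (S k))) ⟩
    ΣL (λ τ → ΣL (λ β → h (shift k τ) β) (S k)) (insertions (suc p') α) ∎
  where open ≡-Reasoning

block-decomposition : ∀ n p → p ≤ n → (h : List ℕ → List ℕ → ℤ) →
  ΣL (λ σ → ⟦ dominates (take p σ) (drop p σ) ⟧ ℤ.* h (take p σ) (drop p σ)) (S n)
  ≡ ΣL (λ α → ΣL (λ β → h (shift (n ∸ p) α) β) (S (n ∸ p))) (S p)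
block-decomposition n zero z≤n h = begin
    ΣL (λ σ → + 1 ℤ.* h [] σ) (S n) ≡⟨ ΣL-cong (S n) (λ σ → ℤP.*-identityˡ _) ⟩
    ΣL (h []) (S n)                 ≡⟨ sym (ℤP.+-identityʳ _) ⟩
    ΣL (h []) (S n) ℤ.+ 0ℤ          ∎
  where open ≡-Reasoning
block-decomposition (suc n') (suc p') (s≤s p'≤n') h = begin
    ΣL term (concatMap (insertions N) (S n'))
      ≡⟨ ΣL-concatMap term (insertions N) (S n') ⟩
    ΣL (λ ρ → ΣL term (insertions N ρ)) (S n')
      ≡⟨ ΣL-cong (S n') (λ ρ → ΣL-insertions N ρ term) ⟩
    ΣL (λ ρ → Σ≤ (length ρ) (λ q → term (ins q N ρ))) (S n')
      ≡⟨ ΣL-congᴾ (S-words n') (λ ρ → dominating-insertions n' p' h ρ p'≤n') ⟩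
    ΣL (λ ρ → ⟦ dominates (take p' ρ) (drop p' ρ) ⟧ ℤ.* h′ (take p' ρ) (drop p' ρ)) (S n')
      ≡⟨ block-decomposition n' p' p'≤n' h′ ⟩
    ΣL (λ α → ΣL (λ β → h′ (shift k α) β) (S k)) (S p')
      ≡⟨ ΣL-congᴾ (S-words p') (λ α (|α|≡p' , _) → shifted-insertions p' k N h α N≡k+1+p' |α|≡p') ⟩
    ΣL (λ α → ΣL (λ τ → ΣL (λ β → h (shift k τ) β) (S k)) (insertions (suc p') α)) (S p')
      ≡⟨ sym (ΣL-concatMap (λ τ → ΣL (λ β → h (shift k τ) β) (S k)) (insertions (suc p')) (S p')) ⟩
    ΣL (λ α → ΣL (λ β → h (shift k α) β) (S k)) (S (suc p')) ∎
  where
  open ≡-Reasoning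
  N = suc n'
  k = n' ∸ p'
  term : List ℕ → ℤ
  term σ = ⟦ dominates (take (suc p') σ) (drop (suc p') σ) ⟧ ℤ.* h (take (suc p') σ) (drop (suc p') σ)
  h′ : List ℕ → List ℕ → ℤ
  h′ x y = Σ≤ p' (λ q → h (ins q N x) y)
  N≡k+1+p' : N ≡ k ℕ.+ suc p'
  N≡k+1+p' = trans (cong suc (sym (ℕP.m∸n+n≡m p'≤n'))) (sym (ℕP.+-suc k p'))

-- 132-avoidance of x (N) y for a maximal entry N: it holds iff x dominates
-- y and both x and y avoid 132.

any-++ : ∀ (P : ℕ → Bool) xs ys → any P (xs ++ ys) ≡ any P xs ∨ any P ys
any-++ P [] ys = refl
any-++ P (x ∷ xs) ys = trans (cong (P x ∨_) (any-++ P xs ys)) (sym (BoolP.∨-assoc (P x) _ _))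

any-congᴬ : ∀ (P R : ℕ → Bool) y → All (λ c → P c ≡ R c) y → any P y ≡ any R y
any-congᴬ P R [] [] = refl
any-congᴬ P R (c ∷ y) (Pc≡Rc ∷ rest) = cong₂ _∨_ Pc≡Rc (any-congᴬ P R y rest)

any-mono : ∀ (P R : ℕ → Bool) y → (∀ c → P c ≡ true → R c ≡ true) → any P y ≡ true → any R y ≡ true
any-mono P R [] P⇒R ()
any-mono P R (c ∷ y) P⇒R any-P with P c in Pc
... | true rewrite P⇒R c Pc = refl
... | false with R c
...   | true = refl
...   | false = any-mono P R y P⇒R any-P

has132from⇒any> : ∀ a y → has132from a y ≡ true → any (λ c → a <ᵇ c) y ≡ true
has132from⇒any> a [] ()
has132from⇒any> a (b ∷ l) h with a <ᵇ b
... | true = refl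
... | false = has132from⇒any> a l h

has132from-max : ∀ N y → All (_< N) y → has132from N y ≡ false
has132from-max N [] [] = refl
has132from-max N (b ∷ y) (b<N ∷ y<N) rewrite <ᵇ-false {N} {b} (ℕP.<⇒≤ b<N) = has132from-max N y y<N

∨-absorb-implied : ∀ c p q h u → (q ≡ true → u ≡ true) →
  (c ∧ (p ∨ (false ∨ q))) ∨ (h ∨ u) ≡ ((c ∧ p) ∨ h) ∨ u
∨-absorb-implied c p q h true _
  rewrite BoolP.∨-zeroʳ h | BoolP.∨-zeroʳ (c ∧ (p ∨ (false ∨ q))) | BoolP.∨-zeroʳ ((c ∧ p) ∨ h) = refl
∨-absorb-implied c p true h false q⇒u with q⇒u refl
... | ()
∨-absorb-implied false p false h false _ = refl
∨-absorb-implied true true false h false _ = refl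
∨-absorb-implied true false false h false _ = refl

-- With N the maximum, a is the "1" of a pattern in x (N) y iff it is one in
-- x or some later entry of y exceeds a (with N as the "3").
has132from-split : ∀ a N x y → a < N → All (_< N) x → All (_< N) y →
  has132from a (x ++ N ∷ y) ≡ has132from a x ∨ any (λ c → a <ᵇ c) y
has132from-split a N [] y a<N x<N y<N
  rewrite <ᵇ-true a<N
        | any-congᴬ (λ c → (a <ᵇ c) ∧ (c <ᵇ N)) (λ c → a <ᵇ c) y
            (All.map (λ {c} c<N → trans (cong ((a <ᵇ c) ∧_) (<ᵇ-true c<N)) (BoolP.∧-identityʳ _)) y<N)
  with any (λ c → a <ᵇ c) y in any>
... | true = refl
... | false with has132from a y in h
...   | false = refl
...   | true = sym (trans (sym any>) (has132from⇒any> a y h))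
has132from-split a N (b ∷ x) y a<N (b<N ∷ x<N) y<N
  rewrite any-++ (λ c → (a <ᵇ c) ∧ (c <ᵇ b)) x (N ∷ y)
        | <ᵇ-true a<N | <ᵇ-false {N} {b} (ℕP.<⇒≤ b<N)
        | has132from-split a N x y a<N x<N y<N
  = ∨-absorb-implied (a <ᵇ b) (any (λ c → (a <ᵇ c) ∧ (c <ᵇ b)) x) (any (λ c → (a <ᵇ c) ∧ (c <ᵇ b)) y)
      (has132from a x) (any (λ c → a <ᵇ c) y)
      (any-mono (λ c → (a <ᵇ c) ∧ (c <ᵇ b)) (λ c → a <ᵇ c) y (λ c → first-conjunct (a <ᵇ c) (c <ᵇ b)))
  where
  first-conjunct : ∀ u v → (u ∧ v) ≡ true → u ≡ true
  first-conjunct true v _ = refl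

∨-regroup : ∀ h u g h' hy → (h ∨ u) ∨ (not g ∨ (h' ∨ hy)) ≡ not (not u ∧ g) ∨ ((h ∨ h') ∨ hy)
∨-regroup h true g h' hy = cong (_∨ (not g ∨ (h' ∨ hy))) (BoolP.∨-zeroʳ h)
∨-regroup h false false h' hy = BoolP.∨-zeroʳ (h ∨ false)
∨-regroup true false true h' hy = refl
∨-regroup false false true h' hy = refl

has132-split : ∀ N x y → All (_< N) x → All (_< N) y →
  has132 (x ++ N ∷ y) ≡ not (dominates x y) ∨ (has132 x ∨ has132 y)
has132-split N [] y [] y<N rewrite has132from-max N y y<N = refl
has132-split N (a ∷ x) y (a<N ∷ x<N) y<N
  rewrite has132from-split a N x y a<N x<N y<N | has132-split N x y x<N y<N =
  ∨-regroup (has132from a x) (any (λ c → a <ᵇ c) y) (dominates x y) (has132 x) (has132 y)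

χ : List ℕ → ℤ
χ τ = ⟦ avoids132 τ ⟧

avoid-indicator : ∀ g hx hy →
  ⟦ (if (not g ∨ (hx ∨ hy)) then false else true) ⟧
  ≡ ⟦ g ⟧ ℤ.* (⟦ (if hx then false else true) ⟧ ℤ.* ⟦ (if hy then false else true) ⟧)
avoid-indicator false false false = refl
avoid-indicator false false true = refl
avoid-indicator false true false = refl
avoid-indicator false true true = refl
avoid-indicator true false false = refl
avoid-indicator true false true = refl
avoid-indicator true true false = refl
avoid-indicator true true true = refl

χ-split : ∀ N x y → All (_< N) x → All (_< N) y → χ (x ++ N ∷ y) ≡ ⟦ dominates x y ⟧ ℤ.* (χ x ℤ.* χ y)
χ-split N x y x<N y<N =
  trans (cong (λ b → ⟦ (if b then false else true) ⟧) (has132-split N x y x<N y<N))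
        (avoid-indicator (dominates x y) (has132 x) (has132 y))

<ᵇ-shift : ∀ k a b → ((k ℕ.+ a) <ᵇ (k ℕ.+ b)) ≡ (a <ᵇ b)
<ᵇ-shift zero a b = refl
<ᵇ-shift (suc k) a b = <ᵇ-shift k a b

any-between-shift : ∀ k a b l →
  any (λ c → ((k ℕ.+ a) <ᵇ c) ∧ (c <ᵇ (k ℕ.+ b))) (shift k l) ≡ any (λ c → (a <ᵇ c) ∧ (c <ᵇ b)) l
any-between-shift k a b [] = refl
any-between-shift k a b (c ∷ l) rewrite <ᵇ-shift k a c | <ᵇ-shift k c b | any-between-shift k a b l = refl

has132from-shift : ∀ k a l → has132from (k ℕ.+ a) (shift k l) ≡ has132from a l
has132from-shift k a [] = refl
has132from-shift k a (b ∷ l) rewrite <ᵇ-shift k a b | has132from-shift k a l | any-between-shift k a b l = refl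

has132-shift : ∀ k l → has132 (shift k l) ≡ has132 l
has132-shift k [] = refl
has132-shift k (a ∷ l) rewrite has132from-shift k a l | has132-shift k l = refl

χ-shift : ∀ k l → χ (shift k l) ≡ χ l
χ-shift k l rewrite has132-shift k l = refl

avoiders-decomposition : ∀ n (w : List ℕ → ℤ) →
  ΣL (λ τ → χ τ ℤ.* w τ) (S (suc n))
  ≡ Σ≤ n (λ a → ΣL (λ α → ΣL (λ β → χ α ℤ.* χ β ℤ.* w (shift (n ∸ a) α ++ suc n ∷ β)) (S (n ∸ a))) (S a))
avoiders-decomposition n w = begin
    ΣL (λ τ → χ τ ℤ.* w τ) (concatMap (insertions N) (S n))
      ≡⟨ ΣL-concatMap _ (insertions N) (S n) ⟩
    ΣL (λ σ → ΣL (λ τ → χ τ ℤ.* w τ) (insertions N σ)) (S n)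
      ≡⟨ ΣL-congᴾ (S-words n) (λ σ σ-word → trans (ΣL-insertions N σ _) (split-at-max σ σ-word)) ⟩
    ΣL (λ σ → Σ≤ n (λ q → ⟦ dominates (take q σ) (drop q σ) ⟧ ℤ.* h (take q σ) (drop q σ))) (S n)
      ≡⟨ ΣL-Σ n _ (S n) ⟩
    Σ≤ n (λ q → ΣL (λ σ → ⟦ dominates (take q σ) (drop q σ) ⟧ ℤ.* h (take q σ) (drop q σ)) (S n))
      ≡⟨ Σ-cong n (λ q q≤n → block-decomposition n q q≤n h) ⟩
    Σ≤ n (λ q → ΣL (λ α → ΣL (λ β → h (shift (n ∸ q) α) β) (S (n ∸ q))) (S q))
      ≡⟨ Σ-cong′ n (λ q → ΣL-cong (S q) (λ α → ΣL-cong (S (n ∸ q)) (λ β →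
            cong (λ z → z ℤ.* χ β ℤ.* w (shift (n ∸ q) α ++ N ∷ β)) (χ-shift (n ∸ q) α)))) ⟩
    Σ≤ n (λ a → ΣL (λ α → ΣL (λ β → χ α ℤ.* χ β ℤ.* w (shift (n ∸ a) α ++ N ∷ β)) (S (n ∸ a))) (S a)) ∎
  where
  open ≡-Reasoning
  N = suc n
  h : List ℕ → List ℕ → ℤ
  h x y = χ x ℤ.* χ y ℤ.* w (x ++ N ∷ y)
  split-at-max : ∀ σ → Word n σ →
    Σ≤ (length σ) (λ q → χ (ins q N σ) ℤ.* w (ins q N σ))
    ≡ Σ≤ n (λ q → ⟦ dominates (take q σ) (drop q σ) ⟧ ℤ.* h (take q σ) (drop q σ))
  split-at-max σ (refl , σ⊆[n]) = Σ-cong′ (length σ) (λ q → begin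
      χ (ins q N σ) ℤ.* w (ins q N σ)
        ≡⟨ cong (λ τ → χ τ ℤ.* w τ) (ins-split q N σ) ⟩
      χ (take q σ ++ N ∷ drop q σ) ℤ.* w (take q σ ++ N ∷ drop q σ)
        ≡⟨ cong (ℤ._* w (take q σ ++ N ∷ drop q σ))
                (χ-split N (take q σ) (drop q σ) (AllP.take⁺ q σ<N) (AllP.drop⁺ q σ<N)) ⟩
      ⟦ dominates (take q σ) (drop q σ) ⟧ ℤ.* (χ (take q σ) ℤ.* χ (drop q σ)) ℤ.* w (take q σ ++ N ∷ drop q σ)
        ≡⟨ ℤP.*-assoc ⟦ dominates (take q σ) (drop q σ) ⟧ _ _ ⟩
      ⟦ dominates (take q σ) (drop q σ) ⟧ ℤ.* h (take q σ) (drop q σ) ∎)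
    where σ<N = entries<1+n σ⊆[n]

-- The statistic.  mmpAux m pre l counts the entries of l having at least
-- m larger entries before them, pre being the (reversed) entries read so far.

count> : ℕ → List ℕ → ℕ
count> c = countᵇ (λ b → c <ᵇ b)

mmp-++ : ∀ m pre x l → mmpAux m pre (x ++ l) ≡ mmpAux m pre x ℕ.+ mmpAux m (x ʳ++ pre) l
mmp-++ m pre [] l = refl
mmp-++ m pre (a ∷ x) l rewrite mmp-++ m (a ∷ pre) x l =
  sym (ℕP.+-assoc (if m ≤ᵇ count> a pre then 1 else 0) _ _)

All-ʳ++ : ∀ {P : ℕ → Set} x p → All P x → All P p → All P (x ʳ++ p)
All-ʳ++ [] p _ Pp = Pp
All-ʳ++ (a ∷ x) p (Pa ∷ Px) Pp = All-ʳ++ x (a ∷ p) Px (Pa ∷ Pp)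

count>-larger : ∀ c P B → All (c <_) B → count> c (P ++ B) ≡ count> c P ℕ.+ length B
count>-larger c [] [] [] = refl
count>-larger c [] (b ∷ B) (c<b ∷ c<B) rewrite <ᵇ-true c<b | count>-larger c [] B c<B = refl
count>-larger c (a ∷ P) B c<B rewrite count>-larger c P B c<B =
  sym (ℕP.+-assoc (if c <ᵇ a then 1 else 0) _ _)

count>-smaller : ∀ c P → All (_≤ c) P → count> c P ≡ 0
count>-smaller c [] [] = refl
count>-smaller c (a ∷ P) (a≤c ∷ P≤c) rewrite <ᵇ-false {c} {a} a≤c = count>-smaller c P P≤c

count>-≤-length : ∀ c P → count> c P ≤ length P
count>-≤-length c [] = z≤n
count>-≤-length c (a ∷ P) with c <ᵇ a
... | true = s≤s (count>-≤-length c P)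
... | false = ℕP.m≤n⇒m≤1+n (count>-≤-length c P)

≤ᵇ-+ : ∀ m X L → (m ≤ᵇ X ℕ.+ L) ≡ (m ∸ L ≤ᵇ X)
≤ᵇ-+ m X zero rewrite ℕP.+-identityʳ X = refl
≤ᵇ-+ zero X (suc L) = refl
≤ᵇ-+ (suc m) X (suc L) rewrite ℕP.+-suc X L = trans (<ᵇ-suc m (X ℕ.+ L)) (≤ᵇ-+ m X L)
  where
  <ᵇ-suc : ∀ m k → (m <ᵇ suc k) ≡ (m ≤ᵇ k)
  <ᵇ-suc zero k = refl
  <ᵇ-suc (suc m) k = refl

mmp-larger-prefix : ∀ m k P B y → All (_≤ k) y → All (k <_) B →
  mmpAux m (P ++ B) y ≡ mmpAux (m ∸ length B) P y
mmp-larger-prefix m k P B [] _ _ = refl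
mmp-larger-prefix m k P B (c ∷ y) (c≤k ∷ y≤k) k<B
  rewrite count>-larger c P B (All.map (ℕP.<-≤-trans (s≤s c≤k)) k<B)
        | ≤ᵇ-+ m (count> c P) (length B)
        | mmp-larger-prefix m k (c ∷ P) B y y≤k k<B = refl

count>-shift : ∀ k a P → count> (k ℕ.+ a) (shift k P) ≡ count> a P
count>-shift k a [] = refl
count>-shift k a (b ∷ P) rewrite <ᵇ-shift k a b | count>-shift k a P = refl

mmp-shift : ∀ m k pre l → mmpAux m (shift k pre) (shift k l) ≡ mmpAux m pre l
mmp-shift m k pre [] = refl
mmp-shift m k pre (a ∷ l) rewrite count>-shift k a pre | mmp-shift m k (a ∷ pre) l = refl

-- The additivity of the statistic over the block decomposition
-- τ = shift k α ++ N ∷ β (entries of α in [1,p], of β in [1,k], k + p < N):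
-- N and the entries of shift k α precede every entry of β and exceed it.
mmp-split : ∀ m' k p N α β → All (λ x → 0 < x × x ≤ p) α → k ℕ.+ p < N → All (_≤ k) β →
  mmp (suc m') (shift k α ++ N ∷ β) ≡ mmp (suc m') α ℕ.+ mmp (suc m' ∸ suc (length α)) β
mmp-split m' k p N α β α⊆[p] k+p<N β≤k = begin
    mmpAux m [] (shift k α ++ N ∷ β)
      ≡⟨ mmp-++ m [] (shift k α) (N ∷ β) ⟩
    mmpAux m [] (shift k α) ℕ.+ mmpAux m pre (N ∷ β)
      ≡⟨ cong₂ ℕ._+_ (mmp-shift m k [] α) N-not-counted ⟩
    mmpAux m [] α ℕ.+ mmpAux m ([] ++ (N ∷ pre)) β
      ≡⟨ cong (mmpAux m [] α ℕ.+_) (mmp-larger-prefix m k [] (N ∷ pre) β β≤k (k<N ∷ All-ʳ++ (shift k α) [] k<α′ [])) ⟩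
    mmpAux m [] α ℕ.+ mmpAux (m ∸ suc (length pre)) [] β
      ≡⟨ cong (λ z → mmpAux m [] α ℕ.+ mmpAux (m ∸ suc z) [] β) |pre|≡|α| ⟩
    mmpAux m [] α ℕ.+ mmpAux (m ∸ suc (length α)) [] β ∎
  where
  open ≡-Reasoning
  m = suc m'
  pre = shift k α ʳ++ []
  k<N : k < N
  k<N = ℕP.≤-<-trans (ℕP.m≤m+n k p) k+p<N
  α′≤N : All (_≤ N) (shift k α)
  α′≤N = AllP.map⁺ (All.map (λ (_ , x≤p) → ℕP.<⇒≤ (ℕP.≤-<-trans (ℕP.+-monoʳ-≤ k x≤p) k+p<N)) α⊆[p])
  k<α′ : All (k <_) (shift k α)
  k<α′ = AllP.map⁺ (All.map (λ (0<x , _) → ℕP.m<m+n k 0<x) α⊆[p])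
  N-not-counted : mmpAux m pre (N ∷ β) ≡ mmpAux m (N ∷ pre) β
  N-not-counted rewrite count>-smaller N pre (All-ʳ++ (shift k α) [] α′≤N []) = refl
  |pre|≡|α| : length pre ≡ length α
  |pre|≡|α| = trans (ListP.length-ʳ++ (shift k α)) (trans (ℕP.+-identityʳ _) (ListP.length-map (k ℕ.+_) α))

-- Fewer than m entries in total: no entry can have m larger predecessors.
mmp-short : ∀ m pre l → length pre ℕ.+ length l ≤ m → mmpAux m pre l ≡ 0
mmp-short m pre [] _ = refl
mmp-short m pre (a ∷ l) |pre|+|al|≤m
  rewrite ≤ᵇ-false {m} {count> a pre}
            (ℕP.≤-<-trans (count>-≤-length a pre)
                          (ℕP.<-≤-trans (ℕP.m<m+n (length pre) (s≤s z≤n)) |pre|+|al|≤m))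
  = mmp-short m (a ∷ pre) l (subst (_≤ m) (ℕP.+-suc (length pre) (length l)) |pre|+|al|≤m)

mmp-zero : ∀ pre l → mmpAux 0 pre l ≡ length l
mmp-zero pre [] = refl
mmp-zero pre (a ∷ l) = cong suc (mmp-zero (a ∷ pre) l)

-- Coefficient recurrences.  The coefficients of Q are sums over all of S n
-- of the avoidance indicator times the indicator of the statistic.

avoiders : ℕ → ℤ
avoiders n = ΣL χ (S n)

Qsum : ℕ → ℕ → ℕ → ℤ
Qsum m n i = ΣL (λ σ → χ σ ℤ.* ⟦ mmp m σ ≡ᵇ i ⟧) (S n)

Q≡Qsum : ∀ m n i → Q m n i ≡ Qsum m n i
Q≡Qsum m zero zero = refl
Q≡Qsum m zero (suc i) = refl
Q≡Qsum m (suc n) i =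
  trans (length-filter (λ σ → mmp m σ ℕ.≟ i) (S132 (suc n)))
  (trans (ΣL-filter (λ σ → avoids132 σ Bool.≟ true) (λ σ → ⟦ does (mmp m σ ℕ.≟ i) ⟧) (S (suc n)))
         (ΣL-cong (S (suc n)) (λ σ → cong (λ z → ⟦ z ⟧ ℤ.* ⟦ mmp m σ ≡ᵇ i ⟧) (does-≟true (avoids132 σ)))))
  where
  does-≟true : ∀ b → does (b Bool.≟ true) ≡ b
  does-≟true true = refl
  does-≟true false = refl

⟦+≡⟧-convolution : ∀ u v i → ⟦ u ℕ.+ v ≡ᵇ i ⟧ ≡ Σ≤ i (λ b → ⟦ u ≡ᵇ b ⟧ ℤ.* ⟦ v ≡ᵇ i ∸ b ⟧)
⟦+≡⟧-convolution u v i = sym (trans (Σ-cong′ i (λ b → cong (λ z → ⟦ z ⟧ ℤ.* ⟦ v ≡ᵇ i ∸ b ⟧) (≡ᵇ-sym u b)))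
                                     (collapse (ℕP.≤-<-connex u i)))
  where
  collapse : u ≤ i ⊎ i < u → Σ≤ i (λ b → δ b u ℤ.* ⟦ v ≡ᵇ i ∸ b ⟧) ≡ ⟦ u ℕ.+ v ≡ᵇ i ⟧
  collapse (inj₁ u≤i) = trans (Σ-δ i u _ u≤i) (same-test (v ℕ.≟ i ∸ u))
    where
    same-test : Dec (v ≡ i ∸ u) → ⟦ v ≡ᵇ i ∸ u ⟧ ≡ ⟦ u ℕ.+ v ≡ᵇ i ⟧
    same-test (yes refl) rewrite ≡ᵇ-refl (i ∸ u) | ℕP.m+[n∸m]≡n u≤i | ≡ᵇ-refl i = refl
    same-test (no v≢i-u) rewrite ≡ᵇ-false v≢i-u
                               | ≡ᵇ-false {u ℕ.+ v} {i} (λ e → v≢i-u (trans (sym (ℕP.m+n∸m≡n u v)) (cong (_∸ u) e)))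
                               = refl
  collapse (inj₂ i<u) rewrite ≡ᵇ-false {u ℕ.+ v} {i} (λ e → ℕP.<⇒≱ i<u (subst (u ≤_) e (ℕP.m≤m+n u v))) =
    Σ-δ-beyond i u _ i<u

Qsum-recurrence : ∀ m' n i →
  Qsum (suc m') (suc n) i ≡ Σ≤ n (λ a → Σ≤ i (λ b → Qsum (suc m') a b ℤ.* Qsum (suc m' ∸ suc a) (n ∸ a) (i ∸ b)))
Qsum-recurrence m' n i = begin
    Qsum m (suc n) i
      ≡⟨ avoiders-decomposition n (λ τ → ⟦ mmp m τ ≡ᵇ i ⟧) ⟩
    Σ≤ n (λ a → ΣL (λ α → ΣL (λ β → χ α ℤ.* χ β ℤ.* ⟦ mmp m (shift (n ∸ a) α ++ suc n ∷ β) ≡ᵇ i ⟧) (S (n ∸ a))) (S a))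
      ≡⟨ Σ-cong n (λ a a≤n → ΣL-congᴾ (S-words a) (λ α α-word → ΣL-congᴾ (S-words (n ∸ a)) (λ β β-word →
           split-term a a≤n α β α-word β-word))) ⟩
    Σ≤ n (λ a → ΣL (λ α → ΣL (λ β → Σ≤ i (λ b → left α b ℤ.* right a β b)) (S (n ∸ a))) (S a))
      ≡⟨ Σ-cong′ n (λ a → trans (ΣL-cong (S a) (λ α → ΣL-Σ i _ (S (n ∸ a))))
            (trans (ΣL-Σ i _ (S a)) (Σ-cong′ i (λ b → ΣL-product _ _ (S a) (S (n ∸ a)))))) ⟩
    Σ≤ n (λ a → Σ≤ i (λ b → Qsum m a b ℤ.* Qsum (m ∸ suc a) (n ∸ a) (i ∸ b))) ∎
  where
  open ≡-Reasoning
  m = suc m'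
  left : List ℕ → ℕ → ℤ
  left α b = χ α ℤ.* ⟦ mmp m α ≡ᵇ b ⟧
  right : ℕ → List ℕ → ℕ → ℤ
  right a β b = χ β ℤ.* ⟦ mmp (m ∸ suc a) β ≡ᵇ i ∸ b ⟧
  regroup : ∀ x y u v → x ℤ.* y ℤ.* (u ℤ.* v) ≡ (x ℤ.* u) ℤ.* (y ℤ.* v)
  regroup = solve-∀
  split-term : ∀ a → a ≤ n → ∀ α β → Word a α → Word (n ∸ a) β →
    χ α ℤ.* χ β ℤ.* ⟦ mmp m (shift (n ∸ a) α ++ suc n ∷ β) ≡ᵇ i ⟧ ≡ Σ≤ i (λ b → left α b ℤ.* right a β b)
  split-term a a≤n α β (refl , α⊆[a]) (_ , β⊆[n-a]) = begin
      χ α ℤ.* χ β ℤ.* ⟦ mmp m (shift (n ∸ a) α ++ suc n ∷ β) ≡ᵇ i ⟧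
        ≡⟨ cong (λ z → χ α ℤ.* χ β ℤ.* ⟦ z ≡ᵇ i ⟧)
             (mmp-split m' (n ∸ a) a (suc n) α β α⊆[a] (s≤s (ℕP.≤-reflexive (ℕP.m∸n+n≡m a≤n))) (All.map proj₂ β⊆[n-a])) ⟩
      χ α ℤ.* χ β ℤ.* ⟦ mmp m α ℕ.+ mmp (m ∸ suc a) β ≡ᵇ i ⟧
        ≡⟨ cong (χ α ℤ.* χ β ℤ.*_) (⟦+≡⟧-convolution (mmp m α) (mmp (m ∸ suc a) β) i) ⟩
      χ α ℤ.* χ β ℤ.* Σ≤ i (λ b → ⟦ mmp m α ≡ᵇ b ⟧ ℤ.* ⟦ mmp (m ∸ suc a) β ≡ᵇ i ∸ b ⟧)
        ≡⟨ sym (Σ-*ˡ i (χ α ℤ.* χ β) _) ⟩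
      Σ≤ i (λ b → χ α ℤ.* χ β ℤ.* (⟦ mmp m α ≡ᵇ b ⟧ ℤ.* ⟦ mmp (m ∸ suc a) β ≡ᵇ i ∸ b ⟧))
        ≡⟨ Σ-cong′ i (λ b → regroup (χ α) (χ β) _ _) ⟩
      Σ≤ i (λ b → left α b ℤ.* right a β b) ∎

Qsum-short : ∀ m' a b → a ≤ m' → Qsum (suc m') a b ≡ δ b 0 ℤ.* avoiders a
Qsum-short m' a b a≤m' = begin
    Qsum (suc m') a b
      ≡⟨ ΣL-congᴾ (S-words a) (λ σ (|σ|≡a , _) → cong (λ z → χ σ ℤ.* ⟦ z ≡ᵇ b ⟧)
           (mmp-short (suc m') [] σ (subst (_≤ suc m') (sym |σ|≡a) (ℕP.m≤n⇒m≤1+n a≤m')))) ⟩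
    ΣL (λ σ → χ σ ℤ.* ⟦ 0 ≡ᵇ b ⟧) (S a)
      ≡⟨ ΣL-*ʳ _ χ (S a) ⟩
    avoiders a ℤ.* ⟦ 0 ≡ᵇ b ⟧
      ≡⟨ ℤP.*-comm (avoiders a) _ ⟩
    ⟦ 0 ≡ᵇ b ⟧ ℤ.* avoiders a
      ≡⟨ cong (λ z → ⟦ z ⟧ ℤ.* avoiders a) (≡ᵇ-sym 0 b) ⟩
    δ b 0 ℤ.* avoiders a ∎
  where open ≡-Reasoning

Qsum-zero : ∀ n i → Qsum 0 n i ≡ δ n i ℤ.* avoiders n
Qsum-zero n i = begin
    Qsum 0 n i
      ≡⟨ ΣL-congᴾ (S-words n) (λ σ (|σ|≡n , _) → cong (λ z → χ σ ℤ.* ⟦ z ≡ᵇ i ⟧) (trans (mmp-zero [] σ) |σ|≡n)) ⟩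
    ΣL (λ σ → χ σ ℤ.* δ n i) (S n)
      ≡⟨ ΣL-*ʳ _ χ (S n) ⟩
    avoiders n ℤ.* δ n i
      ≡⟨ ℤP.*-comm (avoiders n) _ ⟩
    δ n i ℤ.* avoiders n ∎
  where open ≡-Reasoning

segner : ∀ n → avoiders (suc n) ≡ Σ≤ n (λ a → avoiders a ℤ.* avoiders (n ∸ a))
segner n = begin
    avoiders (suc n)
      ≡⟨ ΣL-cong (S (suc n)) (λ τ → sym (ℤP.*-identityʳ (χ τ))) ⟩
    ΣL (λ τ → χ τ ℤ.* + 1) (S (suc n))
      ≡⟨ avoiders-decomposition n (λ _ → + 1) ⟩
    Σ≤ n (λ a → ΣL (λ α → ΣL (λ β → χ α ℤ.* χ β ℤ.* + 1) (S (n ∸ a))) (S a))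
      ≡⟨ Σ-cong′ n (λ a → trans (ΣL-cong (S a) (λ α → ΣL-cong (S (n ∸ a)) (λ β → ℤP.*-identityʳ _)))
                                (ΣL-product χ χ (S a) (S (n ∸ a)))) ⟩
    Σ≤ n (λ a → avoiders a ℤ.* avoiders (n ∸ a)) ∎
  where open ≡-Reasoning

-- Let
-- catalanPower r n be [tⁿ] of the r-th power of Σ avoiders a tᵃ.  Segner's
-- recurrence gives C^(r+1) = C^r + t C^(r+2); the ballot numbers
--   ballot (s+1) n = (2n+s choose n) - (2n+s choose n+s+1)
-- satisfy the same recurrence and boundary values, so the two agree, and
-- ballot 1 n = (2n choose n) - (2n choose n+1) = Cat n.

catalanPower : ℕ → ℕ → ℤ
catalanPower zero n = δ n 0
catalanPower (suc r) n = Σ≤ n (λ a → avoiders a ℤ.* catalanPower r (n ∸ a))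

catalanPower-at0 : ∀ r → catalanPower r 0 ≡ + 1
catalanPower-at0 zero = refl
catalanPower-at0 (suc r) = trans (ℤP.*-identityˡ (catalanPower r 0)) (catalanPower-at0 r)

catalanPower-recurrence : ∀ r n → catalanPower (suc r) (suc n) ≡ catalanPower r (suc n) ℤ.+ catalanPower (suc (suc r)) n
catalanPower-recurrence r n = begin
    catalanPower (suc r) (suc n)
      ≡⟨ Σ-peel n (λ a → avoiders a ℤ.* catalanPower r (suc n ∸ a)) ⟩
    + 1 ℤ.* catalanPower r (suc n) ℤ.+ Σ≤ n (λ a → avoiders (suc a) ℤ.* catalanPower r (n ∸ a))
      ≡⟨ cong₂ ℤ._+_ (ℤP.*-identityˡ (catalanPower r (suc n)))
                     (Σ-cong′ n (λ a → trans (cong (ℤ._* catalanPower r (n ∸ a)) (segner a)) (sym (Σ-*ʳ a _ _)))) ⟩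
    catalanPower r (suc n) ℤ.+ Σ≤ n (λ a → Σ≤ a (λ x → avoiders x ℤ.* avoiders (a ∸ x) ℤ.* catalanPower r (n ∸ a)))
      ≡⟨ cong (ℤ._+_ (catalanPower r (suc n))) (Σ-triangle n (λ x y z → avoiders x ℤ.* avoiders y ℤ.* catalanPower r z)) ⟩
    catalanPower r (suc n) ℤ.+ Σ≤ n (λ x → Σ≤ (n ∸ x) (λ y → avoiders x ℤ.* avoiders y ℤ.* catalanPower r (n ∸ x ∸ y)))
      ≡⟨ cong (ℤ._+_ (catalanPower r (suc n)))
              (Σ-cong′ n (λ x → trans (Σ-cong′ (n ∸ x) (λ y → ℤP.*-assoc (avoiders x) (avoiders y) _))
                                      (Σ-*ˡ (n ∸ x) (avoiders x) _))) ⟩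
    catalanPower r (suc n) ℤ.+ catalanPower (suc (suc r)) n ∎
  where open ≡-Reasoning

ballot : ℕ → ℕ → ℤ
ballot zero n = δ n 0
ballot (suc s) n = + ((n ℕ.+ n ℕ.+ s) C n) ℤ.- + ((n ℕ.+ n ℕ.+ s) C suc (n ℕ.+ s))

ballot-at0 : ∀ r → ballot r 0 ≡ + 1
ballot-at0 zero = refl
ballot-at0 (suc s) rewrite k>n⇒nCk≡0 {s} {suc s} ℕP.≤-refl = refl

pascal-difference : ∀ K a b →
  + (suc K C suc a) ℤ.- + (suc K C suc b) ≡ (+ (K C suc a) ℤ.- + (K C b)) ℤ.+ (+ (K C a) ℤ.- + (K C suc b))
pascal-difference K a b = begin
    + (suc K C suc a) ℤ.- + (suc K C suc b)
      ≡⟨ cong₂ ℤ._-_ (pascalℤ a) (pascalℤ b) ⟩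
    (+ (K C a) ℤ.+ + (K C suc a)) ℤ.- (+ (K C b) ℤ.+ + (K C suc b))
      ≡⟨ regroup (+ (K C a)) (+ (K C suc a)) (+ (K C b)) (+ (K C suc b)) ⟩
    (+ (K C suc a) ℤ.- + (K C b)) ℤ.+ (+ (K C a) ℤ.- + (K C suc b)) ∎
  where
  open ≡-Reasoning
  pascalℤ : ∀ k → + (suc K C suc k) ≡ + (K C k) ℤ.+ + (K C suc k)
  pascalℤ k = trans (cong +_ (sym (nCk+nC[k+1]≡[n+1]C[k+1] K k))) (ℤP.pos-+ (K C k) (K C suc k))
  regroup : ∀ a b c d → (a ℤ.+ b) ℤ.- (c ℤ.+ d) ≡ (b ℤ.- c) ℤ.+ (a ℤ.- d)
  regroup = solve-∀

ballot-recurrence : ∀ r n → ballot (suc r) (suc n) ≡ ballot r (suc n) ℤ.+ ballot (suc (suc r)) n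
ballot-recurrence zero n = begin
    ballot 1 (suc n)
      ≡⟨ cong₂ (λ M j → + (M C suc n) ℤ.- + (M C suc j)) (size n) (ℕP.+-identityʳ (suc n)) ⟩
    + (suc K C suc n) ℤ.- + (suc K C suc (suc n))
      ≡⟨ pascal-difference K n (suc n) ⟩
    (+ (K C suc n) ℤ.- + (K C suc n)) ℤ.+ (+ (K C n) ℤ.- + (K C suc (suc n)))
      ≡⟨ cong₂ ℤ._+_ (ℤP.+-inverseʳ (+ (K C suc n))) (cong (λ j → + (K C n) ℤ.- + (K C suc j)) (ℕP.+-comm 1 n)) ⟩
    ballot 0 (suc n) ℤ.+ ballot 2 n ∎
  where
  open ≡-Reasoning
  K = n ℕ.+ n ℕ.+ 1
  size : ∀ n → suc n ℕ.+ suc n ℕ.+ 0 ≡ suc (n ℕ.+ n ℕ.+ 1)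
  size = ℕSolver.solve-∀
ballot-recurrence (suc s) n = begin
    ballot (suc (suc s)) (suc n)
      ≡⟨ cong₂ (λ M j → + (M C suc n) ℤ.- + (M C suc j)) (size₁ n s) (cong suc (ℕP.+-suc n s)) ⟩
    + (suc K C suc n) ℤ.- + (suc K C suc b)
      ≡⟨ pascal-difference K n b ⟩
    (+ (K C suc n) ℤ.- + (K C b)) ℤ.+ (+ (K C n) ℤ.- + (K C suc b))
      ≡⟨ sym (cong₂ ℤ._+_ (cong (λ M → + (M C suc n) ℤ.- + (M C b)) (size₂ n s))
                          (cong₂ (λ M j → + (M C n) ℤ.- + (M C suc j)) (size₃ n s) (size₄ n s))) ⟩
    ballot (suc s) (suc n) ℤ.+ ballot (suc (suc (suc s))) n ∎
  where
  open ≡-Reasoning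
  K = suc (suc (n ℕ.+ n ℕ.+ s))
  b = suc (suc (n ℕ.+ s))
  size₁ : ∀ n s → suc n ℕ.+ suc n ℕ.+ suc s ≡ suc (suc (suc (n ℕ.+ n ℕ.+ s)))
  size₁ = ℕSolver.solve-∀
  size₂ : ∀ n s → suc n ℕ.+ suc n ℕ.+ s ≡ suc (suc (n ℕ.+ n ℕ.+ s))
  size₂ = ℕSolver.solve-∀
  size₃ : ∀ n s → n ℕ.+ n ℕ.+ suc (suc s) ≡ suc (suc (n ℕ.+ n ℕ.+ s))
  size₃ = ℕSolver.solve-∀
  size₄ : ∀ n s → n ℕ.+ suc (suc s) ≡ suc (suc (n ℕ.+ s))
  size₄ = ℕSolver.solve-∀

catalanPower≡ballot : ∀ n r → catalanPower r n ≡ ballot r n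
catalanPower≡ballot zero r = trans (catalanPower-at0 r) (sym (ballot-at0 r))
catalanPower≡ballot (suc n) zero = refl
catalanPower≡ballot (suc n) (suc r) =
  trans (catalanPower-recurrence r n)
        (trans (cong₂ ℤ._+_ (catalanPower≡ballot (suc n) r) (catalanPower≡ballot n (suc (suc r))))
               (sym (ballot-recurrence r n)))

absorption : ∀ M k → suc k ℕ.* (M C suc k) ≡ (M ∸ k) ℕ.* (M C k)
absorption M zero = trans (ℕP.+-identityʳ _) (trans (nC1≡n M) (sym (ℕP.*-identityʳ M)))
absorption zero (suc k) = ℕP.*-zeroʳ (suc (suc k))
absorption (suc M) (suc k) with ℕP.<-≤-connex k M
... | inj₁ k<M = begin
    suc (suc k) ℕ.* (suc M C suc (suc k))
      ≡⟨ cong (suc (suc k) ℕ.*_) (sym (nCk+nC[k+1]≡[n+1]C[k+1] M (suc k))) ⟩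
    suc (suc k) ℕ.* (X ℕ.+ (M C suc (suc k)))
      ≡⟨ ℕP.*-distribˡ-+ (suc (suc k)) X _ ⟩
    suc (suc k) ℕ.* X ℕ.+ suc (suc k) ℕ.* (M C suc (suc k))
      ≡⟨ cong (suc (suc k) ℕ.* X ℕ.+_) (absorption M (suc k)) ⟩
    suc (suc k) ℕ.* X ℕ.+ d ℕ.* X
      ≡⟨ shuffle (suc k) d X ⟩
    suc k ℕ.* X ℕ.+ suc d ℕ.* X
      ≡⟨ cong₂ (λ u v → u ℕ.+ v ℕ.* X) (absorption M k) (sym M-k≡1+d) ⟩
    (M ∸ k) ℕ.* (M C k) ℕ.+ (M ∸ k) ℕ.* X
      ≡⟨ sym (ℕP.*-distribˡ-+ (M ∸ k) (M C k) X) ⟩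
    (M ∸ k) ℕ.* ((M C k) ℕ.+ X)
      ≡⟨ cong ((M ∸ k) ℕ.*_) (nCk+nC[k+1]≡[n+1]C[k+1] M k) ⟩
    (M ∸ k) ℕ.* (suc M C suc k) ∎
  where
  open ≡-Reasoning
  X = M C suc k
  d = M ∸ suc k
  M-k≡1+d : M ∸ k ≡ suc d
  M-k≡1+d = ℕP.+-∸-assoc 1 k<M
  shuffle : ∀ a b x → suc a ℕ.* x ℕ.+ b ℕ.* x ≡ a ℕ.* x ℕ.+ suc b ℕ.* x
  shuffle = ℕSolver.solve-∀
... | inj₂ M≤k = begin
    suc (suc k) ℕ.* (suc M C suc (suc k))
      ≡⟨ cong (suc (suc k) ℕ.*_) (k>n⇒nCk≡0 (s≤s (s≤s M≤k))) ⟩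
    suc (suc k) ℕ.* 0
      ≡⟨ ℕP.*-zeroʳ (suc (suc k)) ⟩
    0
      ≡⟨ sym (cong (ℕ._* (suc M C suc k)) (ℕP.m≤n⇒m∸n≡0 M≤k)) ⟩
    (M ∸ k) ℕ.* (suc M C suc k) ∎
  where open ≡-Reasoning

avoiders≡Cat : ∀ n → avoiders n ≡ + Cat n
avoiders≡Cat n = begin
    avoiders n
      ≡⟨ sym (Σ-δ-last n avoiders) ⟩
    catalanPower 1 n
      ≡⟨ catalanPower≡ballot n 1 ⟩
    + ((n ℕ.+ n ℕ.+ 0) C n) ℤ.- + ((n ℕ.+ n ℕ.+ 0) C suc (n ℕ.+ 0))
      ≡⟨ cong₂ (λ M j → + (M C n) ℤ.- + (M C suc j)) (ℕP.+-identityʳ (n ℕ.+ n)) (ℕP.+-identityʳ n) ⟩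
    + X ℤ.- + Y
      ≡⟨ trans (ℤP.m-n≡m⊖n X Y) (ℤP.⊖-≥ Y≤X) ⟩
    + (X ∸ Y)
      ≡⟨ cong +_ (sym (trans (cong (λ M → (M C n) / suc n) 2n≡n+n)
                             (trans (cong (_/ suc n) X≡[X-Y][n+1]) (m*n/n≡m (X ∸ Y) (suc n))))) ⟩
    + Cat n ∎
  where
  open ≡-Reasoning
  X = (n ℕ.+ n) C n
  Y = (n ℕ.+ n) C suc n
  [n+1]Y≡nX : suc n ℕ.* Y ≡ n ℕ.* X
  [n+1]Y≡nX = trans (absorption (n ℕ.+ n) n) (cong (ℕ._* X) (ℕP.m+n∸n≡m n n))
  Y≤X : Y ≤ X
  Y≤X = ℕP.*-cancelˡ-≤ (suc n) (subst (ℕ._≤ suc n ℕ.* X) (sym [n+1]Y≡nX) (ℕP.*-monoˡ-≤ X (ℕP.n≤1+n n)))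
  2n≡n+n : 2 ℕ.* n ≡ n ℕ.+ n
  2n≡n+n = cong (n ℕ.+_) (ℕP.+-identityʳ n)
  X≡[X-Y][n+1] : X ≡ (X ∸ Y) ℕ.* suc n
  X≡[X-Y][n+1] = sym (begin
      (X ∸ Y) ℕ.* suc n          ≡⟨ ℕP.*-distribʳ-∸ (suc n) X Y ⟩
      X ℕ.* suc n ∸ Y ℕ.* suc n  ≡⟨ cong₂ _∸_ (ℕP.*-comm X (suc n)) (trans (ℕP.*-comm Y (suc n)) [n+1]Y≡nX) ⟩
      suc n ℕ.* X ∸ n ℕ.* X      ≡⟨ ℕP.m+n∸n≡m X (n ℕ.* X) ⟩
      X ∎)

Q-recurrence : ∀ m' n i →
  Q (suc m') (suc n) i ≡ Σ≤ n (λ a → Σ≤ i (λ b → Q (suc m') a b ℤ.* Q (suc m' ∸ suc a) (n ∸ a) (i ∸ b)))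
Q-recurrence m' n i =
  trans (Q≡Qsum (suc m') (suc n) i)
  (trans (Qsum-recurrence m' n i)
         (Σ-cong′ n (λ a → Σ-cong′ i (λ b →
            sym (cong₂ ℤ._*_ (Q≡Qsum (suc m') a b) (Q≡Qsum (suc m' ∸ suc a) (n ∸ a) (i ∸ b)))))))

Q-short : ∀ m' a b → a ≤ m' → Q (suc m') a b ≡ δ b 0 ℤ.* + Cat a
Q-short m' a b a≤m' =
  trans (Q≡Qsum (suc m') a b) (trans (Qsum-short m' a b a≤m') (cong (δ b 0 ℤ.*_) (avoiders≡Cat a)))

Q₀-Ctx : ∀ n i → (Q 0 ⊖ Ctx) n i ≡ 0ℤ
Q₀-Ctx n i rewrite Q≡Qsum 0 n i | Qsum-zero n i | avoiders≡Cat n = ℤP.+-inverseʳ (Ctx n i)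

tpow-⊛ : ∀ j F n i → (tpow j ⊛ F) n i ≡ (if j ≤ᵇ n then F (n ∸ j) i else 0ℤ)
tpow-⊛ j F n i =
  trans (Σ-cong′ n (λ a → trans (Σ-cong′ i (λ b → reorder (δ a j) (δ b 0) (F (n ∸ a) (i ∸ b))))
                                (Σ-δ i 0 (λ b → δ a j ℤ.* F (n ∸ a) (i ∸ b)) z≤n)))
        (collapse (ℕP.≤-<-connex j n))
  where
  reorder : ∀ x y z → x ℤ.* y ℤ.* z ≡ y ℤ.* (x ℤ.* z)
  reorder = solve-∀
  collapse : j ≤ n ⊎ n < j → Σ≤ n (λ a → δ a j ℤ.* F (n ∸ a) i) ≡ (if j ≤ᵇ n then F (n ∸ j) i else 0ℤ)
  collapse (inj₁ j≤n) rewrite ≤ᵇ-true j≤n = Σ-δ n j (λ a → F (n ∸ a) i) j≤n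
  collapse (inj₂ n<j) rewrite ≤ᵇ-false n<j = Σ-δ-beyond n j (λ a → F (n ∸ a) i) n<j

⊛-𝟙 : ∀ F n i → (F ⊛ 𝟙) n i ≡ F n i
⊛-𝟙 F n i =
  trans (Σ-cong′ n (λ a → trans (Σ-cong′ i (λ b → reorder (F a b) (δ (n ∸ a) 0) (δ (i ∸ b) 0)))
                                (trans (Σ-*ʳ i (δ (n ∸ a) 0) (λ b → F a b ℤ.* δ (i ∸ b) 0))
                                       (cong (ℤ._* δ (n ∸ a) 0) (Σ-δ-last i (F a))))))
        (Σ-δ-last n (λ a → F a i))
  where
  reorder : ∀ x y z → x ℤ.* (y ℤ.* z) ≡ x ℤ.* z ℤ.* y
  reorder = solve-∀

⊛-⊖ : ∀ F G H n i → (F ⊛ (G ⊖ H)) n i ≡ (F ⊛ G) n i ℤ.- (F ⊛ H) n i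
⊛-⊖ F G H n i =
  trans (Σ-cong′ n (λ a → trans (Σ-cong′ i (λ b → distrib (F a b) (G (n ∸ a) (i ∸ b)) (H (n ∸ a) (i ∸ b))))
                                (Σ-sub i _ _)))
        (Σ-sub n _ _)
  where
  distrib : ∀ x y z → x ℤ.* (y ℤ.- z) ≡ x ℤ.* y ℤ.- x ℤ.* z
  distrib = solve-∀

⊛-t : ∀ F G n i → (F ⊛ (tpow 1 ⊛ G)) (suc n) i ≡ (F ⊛ G) n i
⊛-t F G n i = begin
    Σ≤ n (λ a → Σ≤ i (λ b → F a b ℤ.* tG (suc n ∸ a) (i ∸ b))) ℤ.+ Σ≤ i (λ b → F (suc n) b ℤ.* tG (suc n ∸ suc n) (i ∸ b))
      ≡⟨ cong₂ ℤ._+_ (Σ-cong n (λ a a≤n → Σ-cong′ i (λ b → cong (F a b ℤ.*_) (shifted a a≤n (i ∸ b)))))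
                     (Σ-zero i (λ b _ → trans (cong (λ z → F (suc n) b ℤ.* tG z (i ∸ b)) (ℕP.n∸n≡0 n))
                                              (trans (cong (F (suc n) b ℤ.*_) (tpow-⊛ 1 G 0 (i ∸ b)))
                                                     (ℤP.*-zeroʳ (F (suc n) b))))) ⟩
    (F ⊛ G) n i ℤ.+ 0ℤ
      ≡⟨ ℤP.+-identityʳ _ ⟩
    (F ⊛ G) n i ∎
  where
  open ≡-Reasoning
  tG = tpow 1 ⊛ G
  shifted : ∀ a → a ≤ n → ∀ y → tG (suc n ∸ a) y ≡ G (n ∸ a) y
  shifted a a≤n y = trans (cong (λ z → tG z y) (ℕP.+-∸-assoc 1 a≤n)) (tpow-⊛ 1 G (suc (n ∸ a)) y)

tC : Ser2
tC = tpow 1 ⊛ Ctx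

cleared-at0 : ∀ m i → (Q m ⊛ (𝟙 ⊖ tC)) 0 i ≡ δ i 0
cleared-at0 m i =
  trans (⊛-⊖ (Q m) 𝟙 tC 0 i)
        (trans (cong₂ ℤ._-_ (⊛-𝟙 (Q m) 0 i)
                            (Σ-zero i (λ b _ → trans (cong (Q m 0 b ℤ.*_) (tpow-⊛ 1 Ctx 0 (i ∸ b)))
                                                     (ℤP.*-zeroʳ (Q m 0 b)))))
               (ℤP.+-identityʳ (δ i 0)))

cleared-coefficient : ∀ m' n i →
  (Q (suc m') ⊛ (𝟙 ⊖ tC)) (suc n) i
  ≡ Σ≤ n (λ a → Σ≤ i (λ b → Q (suc m') a b ℤ.* (Q (suc m' ∸ suc a) ⊖ Ctx) (n ∸ a) (i ∸ b)))
cleared-coefficient m' n i = begin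
    (Q m ⊛ (𝟙 ⊖ tC)) (suc n) i
      ≡⟨ ⊛-⊖ (Q m) 𝟙 tC (suc n) i ⟩
    (Q m ⊛ 𝟙) (suc n) i ℤ.- (Q m ⊛ tC) (suc n) i
      ≡⟨ cong₂ ℤ._-_ (trans (⊛-𝟙 (Q m) (suc n) i) (Q-recurrence m' n i)) (⊛-t (Q m) Ctx n i) ⟩
    Σ≤ n (λ a → Σ≤ i (λ b → Q m a b ℤ.* Q (m ∸ suc a) (n ∸ a) (i ∸ b)))
      ℤ.- Σ≤ n (λ a → Σ≤ i (λ b → Q m a b ℤ.* Ctx (n ∸ a) (i ∸ b)))
      ≡⟨ sym (trans (Σ-cong′ n (λ a → Σ-sub i _ _)) (Σ-sub n _ _)) ⟩
    Σ≤ n (λ a → Σ≤ i (λ b → Q m a b ℤ.* Q (m ∸ suc a) (n ∸ a) (i ∸ b) ℤ.- Q m a b ℤ.* Ctx (n ∸ a) (i ∸ b)))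
      ≡⟨ Σ-cong′ n (λ a → Σ-cong′ i (λ b → factor (Q m a b) _ _)) ⟩
    Σ≤ n (λ a → Σ≤ i (λ b → Q m a b ℤ.* (Q (m ∸ suc a) ⊖ Ctx) (n ∸ a) (i ∸ b))) ∎
  where
  open ≡-Reasoning
  m = suc m'
  factor : ∀ x y z → x ℤ.* y ℤ.- x ℤ.* z ≡ x ℤ.* (y ℤ.- z)
  factor = solve-∀

-- Terms with a > m - 2 involve Q_{m-1-a} - C(tx) = Q_0 - C(tx) = 0.
cleared-term-vanishes : ∀ m' n i a b → m' < suc a → Q (suc m') a b ℤ.* (Q (suc m' ∸ suc a) ⊖ Ctx) (n ∸ a) (i ∸ b) ≡ 0ℤ
cleared-term-vanishes m' n i a b m'<1+a rewrite ℕP.m≤n⇒m∸n≡0 m'<1+a | Q₀-Ctx (n ∸ a) (i ∸ b) =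
  ℤP.*-zeroʳ (Q (suc m') a b)

-- A coefficient Q_m[tᵃ] with a < m is the constant C_a, so convolving it
-- in x does nothing.
short-convolution : ∀ m' a i (F : ℕ → ℤ) → a ≤ m' → Σ≤ i (λ b → Q (suc m') a b ℤ.* F (i ∸ b)) ≡ + Cat a ℤ.* F i
short-convolution m' a i F a≤m' =
  trans (Σ-cong′ i (λ b → trans (cong (ℤ._* F (i ∸ b)) (Q-short m' a b a≤m')) (ℤP.*-assoc (δ b 0) (+ Cat a) _)))
        (Σ-δ i 0 (λ b → + Cat a ℤ.* F (i ∸ b)) z≤n)

identity-m1 : (Q 1 ⊛ (𝟙 ⊖ tC)) ≋ 𝟙
identity-m1 zero i = trans (cleared-at0 1 i) (sym (ℤP.*-identityˡ (δ i 0)))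
identity-m1 (suc n) i =
  trans (cleared-coefficient 0 n i)
        (trans (Σ-zero n (λ a _ → Σ-zero i (λ b _ → cleared-term-vanishes 0 n i a b (s≤s z≤n))))
               (sym (ℤP.*-zeroˡ (δ i 0))))

module General (k' : ℕ) where

  m = suc (suc k')

  -- Y j = Q_{m-1-j} - C(tx); the numerator is 1 + t X with X = Σ_{j ≤ m-2} C_j tʲ Y j.
  Y : ℕ → Ser2
  Y j = Q (suc k' ∸ j) ⊖ Ctx

  X : Ser2
  X = ΣS k' (λ j → (+ Cat j) · (tpow j ⊛ Y j))

  X₀ : Ser1
  X₀ = ΣS₁ k' (λ j → (+ Cat j) ·₁ (tpow₁ j ⊛₁ (at0 (Q (suc k' ∸ j)) ⊖₁ 𝟙₁)))

  -- Only blocks of length a ≤ m - 2 survive in cleared-coefficient, and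
  -- for those Q_m[tᵃ] = C_a.
  identity : (Q m ⊛ (𝟙 ⊖ tC)) ≋ (𝟙 ⊕ (tpow 1 ⊛ X))
  identity zero i =
    trans (cleared-at0 m i) (sym (trans (cong₂ ℤ._+_ (ℤP.*-identityˡ (δ i 0)) (tpow-⊛ 1 X 0 i)) (ℤP.+-identityʳ _)))
  identity (suc n) i = begin
      (Q m ⊛ (𝟙 ⊖ tC)) (suc n) i
        ≡⟨ cleared-coefficient (suc k') n i ⟩
      Σ≤ n (λ a → Σ≤ i (λ b → Q m a b ℤ.* Y a (n ∸ a) (i ∸ b)))
        ≡⟨ Σ-cong′ n only-short-blocks ⟩
      Σ≤ n (λ a → if a ≤ᵇ k' then g a else 0ℤ)
        ≡⟨ Σ-restrict-swap n k' g ⟩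
      Σ≤ k' (λ a → if a ≤ᵇ n then g a else 0ℤ)
        ≡⟨ sym (Σ-cong′ k' (λ j → trans (cong (+ Cat j ℤ.*_) (tpow-⊛ j (Y j) n i)) (*-if (+ Cat j) (j ≤ᵇ n) _))) ⟩
      X n i
        ≡⟨ sym (ℤP.+-identityˡ (X n i)) ⟩
      0ℤ ℤ.+ X n i
        ≡⟨ cong₂ ℤ._+_ (sym (ℤP.*-zeroˡ (δ i 0))) (sym (tpow-⊛ 1 X (suc n) i)) ⟩
      (𝟙 ⊕ (tpow 1 ⊛ X)) (suc n) i ∎
    where
    open ≡-Reasoning
    g : ℕ → ℤ
    g a = + Cat a ℤ.* Y a (n ∸ a) i
    *-if : ∀ (c : ℤ) b x → c ℤ.* (if b then x else 0ℤ) ≡ (if b then c ℤ.* x else 0ℤ)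
    *-if c true x = refl
    *-if c false x = ℤP.*-zeroʳ c
    only-short-blocks : ∀ a → Σ≤ i (λ b → Q m a b ℤ.* Y a (n ∸ a) (i ∸ b)) ≡ (if a ≤ᵇ k' then g a else 0ℤ)
    only-short-blocks a with ℕP.≤-<-connex a k'
    ... | inj₁ a≤k' rewrite ≤ᵇ-true a≤k' = short-convolution (suc k') a i (Y a (n ∸ a)) (ℕP.m≤n⇒m≤1+n a≤k')
    ... | inj₂ k'<a rewrite ≤ᵇ-false k'<a = Σ-zero i (λ b _ → cleared-term-vanishes (suc k') n i a b (s≤s k'<a))

  -- Specialising the general identity to x = 0, where C(tx) becomes 1.
  identity-at-x0 : (at0 (Q m) ⊛₁ (𝟙₁ ⊖₁ tpow₁ 1)) ≋₁ (𝟙₁ ⊕₁ (tpow₁ 1 ⊛₁ X₀))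
  identity-at-x0 n = trans (sym left-at0) (trans (identity n 0) right-at0)
    where
    Ctx-at0 : ∀ y → Ctx y 0 ≡ δ y 0
    Ctx-at0 zero = refl
    Ctx-at0 (suc y) = ℤP.*-zeroˡ (+ Cat (suc y))
    denominator-at0 : ∀ y → 𝟙 y 0 ℤ.- tC y 0 ≡ δ y 0 ℤ.- δ y 1
    denominator-at0 zero = refl
    denominator-at0 (suc y) = cong₂ ℤ._-_ (ℤP.*-zeroˡ (+ 1)) (trans (tpow-⊛ 1 Ctx (suc y) 0) (Ctx-at0 y))
    left-at0 : (Q m ⊛ (𝟙 ⊖ tC)) n 0 ≡ (at0 (Q m) ⊛₁ (𝟙₁ ⊖₁ tpow₁ 1)) n
    left-at0 = Σ-cong′ n (λ a → cong (Q m a 0 ℤ.*_) (denominator-at0 (n ∸ a)))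
    X-at0 : ∀ y → X y 0 ≡ X₀ y
    X-at0 y = Σ-cong′ k' (λ j → cong (+ Cat j ℤ.*_) (Σ-cong′ y (λ a →
                cong₂ ℤ._*_ (ℤP.*-identityʳ (δ a j)) (cong (ℤ._-_ (Q (suc k' ∸ j) (y ∸ a) 0)) (Ctx-at0 (y ∸ a))))))
    right-at0 : (𝟙 ⊕ (tpow 1 ⊛ X)) n 0 ≡ (𝟙₁ ⊕₁ (tpow₁ 1 ⊛₁ X₀)) n
    right-at0 = cong₂ ℤ._+_ (ℤP.*-identityʳ (δ n 0)) (Σ-cong′ n (λ a → cong₂ ℤ._*_ (ℤP.*-identityʳ (δ a 1)) (X-at0 (n ∸ a))))

theorem18 : ((Q 1 ⊛ (𝟙 ⊖ (tpow 1 ⊛ Ctx))) ≋ 𝟙)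
    × (∀ (k' : ℕ) →
         ((Q (suc (suc k')) ⊛ (𝟙 ⊖ (tpow 1 ⊛ Ctx)))
           ≋ (𝟙 ⊕ (tpow 1 ⊛ ΣS k' (λ j → (+ Cat j) · (tpow j ⊛ (Q (suc k' ∸ j) ⊖ Ctx))))))
         × ((at0 (Q (suc (suc k'))) ⊛₁ (𝟙₁ ⊖₁ tpow₁ 1))
           ≋₁ (𝟙₁ ⊕₁ (tpow₁ 1 ⊛₁ ΣS₁ k' (λ j → (+ Cat j) ·₁ (tpow₁ j ⊛₁ (at0 (Q (suc k' ∸ j)) ⊖₁ 𝟙₁)))))))
theorem18 = identity-m1 , λ k' → General.identity k' , General.identity-at-x0 k'
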